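{- Let $\Gamma$ be a distance-biregular graph on $n$ vertices with stable sets $V_0,V_1$. Then for each $y\in V_\ell$, $\ell\in\{0,1\}$, and each $x\in V$, the group inverse of the Laplacian matrix $\mathsf L$ satisfies $$\mathsf L^\#(x,y)=\frac1n\sum_{j=d(x,y)+1}^{D_\ell}\frac{n-B_{\ell,j-1}}{k_{\ell,j}c_{\ell,j}}-\frac1{n^2}\sum_{j=1}^{D_\ell}\frac{B_{\ell,j-1}(n-B_{\ell,j-1})}{k_{\ell,j}c_{\ell,j}}.$$
   Context: Graphs are finite, connected, simple, $n=|V|\ge2$, $d$ the graph distance, $\Gamma_i(x)=\{y:d(x,y)=i\}$. $\mathsf L$ is the combinatorial Laplacian matrix (degree diagonal matrix minus adjacency matrix) and $\mathsf L^\#$ its group inverse (the unique matrix $X$ with $\mathsf LX\mathsf L=\mathsf L$, $X\mathsf LX=X$, $\mathsf LX=X\mathsf L$). A distance-biregular graph is a connected bipartite graph with stable sets $V_0,V_1$, every vertex in $V_\ell$ of degree $k_\ell$, such that for vertices $x,y$ at distance $i$ the numbers $|\Gamma_{i-1}(x)\cap\Gamma_1(y)|$ and $|\Gamma_{i+1}(x)\cap\Gamma_1(y)|$ depend only on $i$ and the stable set $V_\ell$ of $x$; they are denoted $c_{\ell,i}$, $b_{\ell,i}$. $D_\ell=\max\{d(x,y):x\in V_\ell,y\in V\}$; for $x\in V_\ell$, $k_{\ell,i}=|\Gamma_i(x)|$ and $B_{\ell,i}=\sum_{j=0}^ik_{\ell,j}$. An empty sum equals $0$. -}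

module Defs where

open import Data.Bool using (Bool; true; false; _∧_; _∨_; if_then_else_)
import Data.Bool
open import Data.Nat as ℕ using (ℕ; zero; suc; _≡ᵇ_; _⊔_; _∸_)
open import Data.Fin using (Fin; zero; suc)
open import Data.Fin.Properties using (_≟_)
open import Data.Integer as ℤ using (ℤ; +_)
open import Data.Rational using (ℚ; 0ℚ; 1ℚ; _+_; _*_; -_; _-_; _/_)
open import Relation.Nullary.Decidable using (⌊_⌋)
open import Relation.Binary.PropositionalEquality using (_≡_; _≢_)
open import Data.Product using (∃)

sumFin : {n : ℕ} → (Fin n → ℚ) → ℚ
sumFin {zero}  f = 0ℚ
sumFin {suc n} f = f zero + sumFin (λ i → f (suc i))

countFin : {n : ℕ} → (Fin n → Bool) → ℕ
countFin {zero}  p = 0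
countFin {suc n} p = (if p zero then 1 else 0) ℕ.+ countFin (λ i → p (suc i))

anyFin : {n : ℕ} → (Fin n → Bool) → Bool
anyFin {zero}  p = false
anyFin {suc n} p = p zero ∨ anyFin (λ i → p (suc i))

maxFin : {n : ℕ} → (Fin n → ℕ) → ℕ
maxFin {zero}  f = 0
maxFin {suc n} f = f zero ⊔ maxFin (λ i → f (suc i))

sumBelowℕ : ℕ → (ℕ → ℕ) → ℕ
sumBelowℕ zero    g = 0
sumBelowℕ (suc m) g = sumBelowℕ m g ℕ.+ g m

sumBelow : ℕ → (ℕ → ℚ) → ℚ
sumBelow zero    g = 0ℚ
sumBelow (suc m) g = sumBelow m g + g m

-- Σ_{j = a}^{b} f j ; empty (= 0) when a > b
sumRange : ℕ → ℕ → (ℕ → ℚ) → ℚ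
sumRange a b f = sumBelow (suc b ∸ a) (λ t → f (a ℕ.+ t))

-- least i < fuel with p i, or fuel if none
least : ℕ → (ℕ → Bool) → ℕ
least zero    p = zero
least (suc f) p = if p 0 then 0 else suc (least f (λ i → p (suc i)))

-- total division ℤ / ℕ (only ever used with positive denominators)
_/ₜ_ : ℤ → ℕ → ℚ
i /ₜ zero  = 0ℚ
i /ₜ suc m = i / suc m

eqF : {n : ℕ} → Fin n → Fin n → Bool
eqF x y = ⌊ x ≟ y ⌋

record SimpleGraph (n : ℕ) : Set where
  field
    adj     : Fin n → Fin n → Bool
    symm    : ∀ x y → adj x y ≡ adj y x
    irrefl  : ∀ x → adj x x ≡ false

module _ {n : ℕ} (G : SimpleGraph n) where
  open SimpleGraph G

  -- reach i x y = true  iff  there is a walk of length ≤ i from x to y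
  reach : ℕ → Fin n → Fin n → Bool
  reach zero    x y = eqF x y
  reach (suc i) x y = reach i x y ∨ anyFin (λ z → reach i x z ∧ adj z y)

  Connected : Set
  Connected = ∀ x y → ∃ λ i → reach i x y ≡ true

  -- graph distance: least i with a walk of length ≤ i (exact for connected graphs)
  dist : Fin n → Fin n → ℕ
  dist x y = least n (λ i → reach i x y)

  deg : Fin n → ℕ
  deg x = countFin (adj x)

  sphere : Fin n → ℕ → ℕ
  sphere x i = countFin (λ z → dist x z ≡ᵇ i)

  ball : Fin n → ℕ → ℕ
  ball x i = sumBelowℕ (suc i) (sphere x)

  ecc : Fin n → ℕ
  ecc x = maxFin (dist x)

  laplacian : Fin n → Fin n → ℚ
  laplacian x y =
    if eqF x y then (+ deg x) / 1
    else (if adj x y then - 1ℚ else 0ℚ)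

  -- Distance-biregularity with respect to a bipartition `side`
  -- (V₀ = side⁻¹ false, V₁ = side⁻¹ true) and parameters k, c, b.
  record IsDistanceBiregular (side : Fin n → Bool) (k : Bool → ℕ)
                             (c b : Bool → ℕ → ℕ) : Set where
    field
      connected : Connected
      bipartite : ∀ x y → adj x y ≡ true → side x ≢ side y
      degree    : ∀ x → deg x ≡ k (side x)
      c-const   : ∀ x y i → dist x y ≡ suc i →
                  countFin (λ z → (dist x z ≡ᵇ i) ∧ (dist y z ≡ᵇ 1)) ≡ c (side x) (suc i)
      b-const   : ∀ x y i → dist x y ≡ i →
                  countFin (λ z → (dist x z ≡ᵇ suc i) ∧ (dist y z ≡ᵇ 1)) ≡ b (side x) i

  diamSide : (side : Fin n → Bool) → Bool → ℕ
  diamSide side ℓ = maxFin (λ z → if ⌊ Data.Bool._≟_ (side z) ℓ ⌋ then ecc z else 0)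

Matrix : ℕ → Set
Matrix n = Fin n → Fin n → ℚ

_⊗_ : {n : ℕ} → Matrix n → Matrix n → Matrix n
(A ⊗ B) i j = sumFin (λ t → A i t * B t j)

_≐_ : {n : ℕ} → Matrix n → Matrix n → Set
A ≐ B = ∀ i j → A i j ≡ B i j

record IsGroupInverse {n : ℕ} (L X : Matrix n) : Set where
  field
    LXL≡L : ((L ⊗ X) ⊗ L) ≐ L
    XLX≡X : ((X ⊗ L) ⊗ X) ≐ X
    LX≡XL : (L ⊗ X) ≐ (X ⊗ L)

-- If L has zero row sums and some Z with zero column sums satisfies L Z = I - J/n, then any
-- group inverse X of L equals Z: X L is forced to be I - J/n, and then X = X L X = X L Z = Z.
-- For y in V_ℓ take Z(x,y) = g(d(x,y)) with g(i) = (1/n) Σ_{i<j≤D_ℓ} a_j - K and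
-- a_j = (n - B_{ℓ,j-1}) / (k_{ℓ,j} c_{ℓ,j}); this is the claimed formula. A vertex at distance i
-- from y has c_{ℓ,i} neighbours at distance i-1 and b_{ℓ,i} at distance i+1, counting the edges
-- between consecutive spheres gives k_i b_i = k_{i+1} c_{i+1}, and k_{i+1} c_{i+1} (g(i) - g(i+1))
-- = (n - B_i)/n; so k_i (L Z)(x,y) telescopes to k_i (δ_{xy} - 1/n). Summation by parts shows that
-- K is precisely the constant making Σ_x Z(x,y) = Σ_i k_i g(i) vanish.

module Submission where

open import Data.Bool using (Bool; true; false; if_then_else_; _∧_; _∨_; not)
import Data.Bool
open import Data.Bool.Properties using (∨-zeroʳ; T-≡)
open import Function.Bundles using (Equivalence)
open import Data.Nat as ℕ
  using (ℕ; zero; suc; _≤_; _<_; z≤n; s≤s; _≡ᵇ_; _<ᵇ_; _≤ᵇ_; _∸_)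
import Data.Nat.Properties as ℕ
open import Data.Fin using (Fin; zero; suc; toℕ; inject₁)
import Data.Fin.Properties as Fin
open import Data.Integer as ℤ using (ℤ)
import Data.Integer.Properties as ℤ
open import Data.Rational
  using (ℚ; NonZero; 0ℚ; 1ℚ; _+_; _*_; -_; _-_; _/_; 1/_; toℚᵘ)
open import Data.Rational.Properties
import Data.Rational.Unnormalised as ℚᵘ
import Data.Rational.Unnormalised.Properties as ℚᵘ
open import Data.Rational.Solver using (module +-*-Solver)
open import Algebra.Bundles using (CommutativeRing)
open import Algebra.Properties.Semiring.Sum (CommutativeRing.semiring +-*-commutativeRing)
  using (sum; sum-cong-≗; sum-init-last; sum-replicate-zero; ∑-distrib-+; ∑-comm; *-distribˡ-sum)
open import Data.Product using (∃; _,_; _×_; proj₁; proj₂)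
open import Data.Sum using (_⊎_; inj₁; inj₂)
open import Data.Empty using (⊥-elim)
open import Relation.Nullary using (¬_; yes; no)
open import Relation.Nullary.Decidable using (⌊_⌋)
open import Relation.Binary.Definitions using (Tri; tri<; tri≈; tri>)
open import Relation.Binary.PropositionalEquality
open import Data.Nat.GeneralisedArithmetic using (fold)
open import Relation.Binary.Bundles using (Setoid)
open import Level using (0ℓ)
open import Defs

open ≡-Reasoning
open +-*-Solver

fromℤ : ℤ → ℚ
fromℤ i = i / 1

fromℕ : ℕ → ℚ
fromℕ m = fromℤ (ℤ.+ m)

private
  toℚᵘ-fromℤ : ∀ i → toℚᵘ (fromℤ i) ℚᵘ.≃ ℚᵘ.mkℚᵘ i 0
  toℚᵘ-fromℤ i = toℚᵘ-fromℚᵘ (ℚᵘ.mkℚᵘ i 0)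

  toℚᵘ-/ : ∀ i m → toℚᵘ (i / suc m) ℚᵘ.≃ ℚᵘ.mkℚᵘ i m
  toℚᵘ-/ i m = toℚᵘ-fromℚᵘ (ℚᵘ.mkℚᵘ i m)

module _ where
  open ℚᵘ.≤-Reasoning renaming (_∎ to _∎ᵘ)

  fromℤ-+ : ∀ i j → fromℤ (i ℤ.+ j) ≡ fromℤ i + fromℤ j
  fromℤ-+ i j = toℚᵘ-injective (begin-equality
    toℚᵘ (fromℤ (i ℤ.+ j))              ≃⟨ toℚᵘ-fromℤ _ ⟩
    ℚᵘ.mkℚᵘ (i ℤ.+ j) 0                 ≃⟨ ℚᵘ.*≡* (cong (ℤ._* ℤ.+ 1) cross) ⟩
    ℚᵘ.mkℚᵘ i 0 ℚᵘ.+ ℚᵘ.mkℚᵘ j 0        ≃⟨ ℚᵘ.+-cong (toℚᵘ-fromℤ i) (toℚᵘ-fromℤ j) ⟨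
    toℚᵘ (fromℤ i) ℚᵘ.+ toℚᵘ (fromℤ j)  ≃⟨ toℚᵘ-homo-+ (fromℤ i) (fromℤ j) ⟨
    toℚᵘ (fromℤ i + fromℤ j)            ∎ᵘ)
    where
    cross : i ℤ.+ j ≡ i ℤ.* ℤ.+ 1 ℤ.+ j ℤ.* ℤ.+ 1
    cross = sym (cong₂ ℤ._+_ (ℤ.*-identityʳ i) (ℤ.*-identityʳ j))

  fromℤ-* : ∀ i j → fromℤ (i ℤ.* j) ≡ fromℤ i * fromℤ j
  fromℤ-* i j = toℚᵘ-injective (begin-equality
    toℚᵘ (fromℤ (i ℤ.* j))             ≃⟨ toℚᵘ-fromℤ _ ⟩
    ℚᵘ.mkℚᵘ i 0 ℚᵘ.* ℚᵘ.mkℚᵘ j 0       ≃⟨ ℚᵘ.*-cong (toℚᵘ-fromℤ i) (toℚᵘ-fromℤ j) ⟨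
    toℚᵘ (fromℤ i) ℚᵘ.* toℚᵘ (fromℤ j) ≃⟨ toℚᵘ-homo-* (fromℤ i) (fromℤ j) ⟨
    toℚᵘ (fromℤ i * fromℤ j)           ∎ᵘ)

  fromℤ-neg : ∀ i → fromℤ (ℤ.- i) ≡ - fromℤ i
  fromℤ-neg i = toℚᵘ-injective (begin-equality
    toℚᵘ (fromℤ (ℤ.- i))   ≃⟨ toℚᵘ-fromℤ _ ⟩
    ℚᵘ.- ℚᵘ.mkℚᵘ i 0       ≃⟨ ℚᵘ.-‿cong (toℚᵘ-fromℤ i) ⟨
    ℚᵘ.- toℚᵘ (fromℤ i)    ≃⟨ toℚᵘ-homo‿- (fromℤ i) ⟨
    toℚᵘ (- fromℤ i)       ∎ᵘ)

  /ₜ-*-cancel : ∀ i m → (i /ₜ suc m) * fromℕ (suc m) ≡ fromℤ i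
  /ₜ-*-cancel i m = toℚᵘ-injective (begin-equality
    toℚᵘ ((i / suc m) * fromℕ (suc m))
      ≃⟨ toℚᵘ-homo-* (i / suc m) (fromℕ (suc m)) ⟩
    toℚᵘ (i / suc m) ℚᵘ.* toℚᵘ (fromℕ (suc m))
      ≃⟨ ℚᵘ.*-cong (toℚᵘ-/ i m) (toℚᵘ-fromℤ (ℤ.+ suc m)) ⟩
    ℚᵘ.mkℚᵘ i m ℚᵘ.* ℚᵘ.mkℚᵘ (ℤ.+ suc m) 0
      ≃⟨ ℚᵘ.*≡* cross ⟩
    ℚᵘ.mkℚᵘ i 0
      ≃⟨ toℚᵘ-fromℤ i ⟨
    toℚᵘ (fromℤ i) ∎ᵘ)
    where
    cross : (i ℤ.* ℤ.+ suc m) ℤ.* ℤ.+ 1 ≡ i ℤ.* ℤ.+ (suc m ℕ.* 1)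
    cross = trans (ℤ.*-identityʳ _) (cong (λ k → i ℤ.* ℤ.+ k) (sym (ℕ.*-identityʳ (suc m))))

fromℤ-minus : ∀ i j → fromℤ (i ℤ.- j) ≡ fromℤ i - fromℤ j
fromℤ-minus i j = trans (fromℤ-+ i (ℤ.- j)) (cong (fromℤ i +_) (fromℤ-neg j))

fromℕ-+ : ∀ m k → fromℕ (m ℕ.+ k) ≡ fromℕ m + fromℕ k
fromℕ-+ m k = fromℤ-+ (ℤ.+ m) (ℤ.+ k)

fromℕ-* : ∀ m k → fromℕ (m ℕ.* k) ≡ fromℕ m * fromℕ k
fromℕ-* m k = trans (cong fromℤ (ℤ.pos-* m k)) (fromℤ-* (ℤ.+ m) (ℤ.+ k))

*-cancelʳ-nonZero : ∀ {p q} r .{{_ : NonZero r}} → p * r ≡ q * r → p ≡ q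
*-cancelʳ-nonZero {p} {q} r eq = begin
  p                ≡⟨ *-identityʳ p ⟨
  p * 1ℚ           ≡⟨ cong (p *_) (*-inverseʳ r) ⟨
  p * (r * 1/ r)   ≡⟨ *-assoc p r (1/ r) ⟨
  p * r * 1/ r     ≡⟨ cong (_* 1/ r) eq ⟩
  q * r * 1/ r     ≡⟨ *-assoc q r (1/ r) ⟩
  q * (r * 1/ r)   ≡⟨ cong (q *_) (*-inverseʳ r) ⟩
  q * 1ℚ           ≡⟨ *-identityʳ q ⟩
  q                ∎

fromℕ-suc-nonZero : ∀ m → NonZero (fromℕ (suc m))
fromℕ-suc-nonZero m = pos⇒nonZero (fromℕ (suc m)) {{normalize-pos (suc m) 1}}

/ₜ-unique : ∀ {p} i m → p * fromℕ (suc m) ≡ fromℤ i → p ≡ i /ₜ suc m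
/ₜ-unique i m eq =
  *-cancelʳ-nonZero (fromℕ (suc m)) {{fromℕ-suc-nonZero m}} (trans eq (sym (/ₜ-*-cancel i m)))

/ₜ-*ˡ : ∀ i j m → (i ℤ.* j) /ₜ m ≡ fromℤ i * (j /ₜ m)
/ₜ-*ˡ i j zero    = sym (*-zeroʳ (fromℤ i))
/ₜ-*ˡ i j (suc m) = sym (/ₜ-unique (i ℤ.* j) m (begin
  fromℤ i * (j /ₜ suc m) * fromℕ (suc m)   ≡⟨ *-assoc (fromℤ i) _ _ ⟩
  fromℤ i * ((j /ₜ suc m) * fromℕ (suc m)) ≡⟨ cong (fromℤ i *_) (/ₜ-*-cancel j m) ⟩
  fromℤ i * fromℤ j                        ≡⟨ fromℤ-* i j ⟨
  fromℤ (i ℤ.* j)                          ∎))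

true≢false : true ≢ false
true≢false ()

¬T⇒≡false : ∀ {b} → ¬ Data.Bool.T b → b ≡ false
¬T⇒≡false {false} _  = refl
¬T⇒≡false {true}  ¬t = ⊥-elim (¬t _)

≡ᵇ-refl : ∀ m → (m ≡ᵇ m) ≡ true
≡ᵇ-refl zero    = refl
≡ᵇ-refl (suc m) = ≡ᵇ-refl m

≡ᵇ⇒≡ : ∀ {m k} → (m ≡ᵇ k) ≡ true → m ≡ k
≡ᵇ⇒≡ {m} {k} e = ℕ.≡ᵇ⇒≡ m k (subst Data.Bool.T (sym e) _)

≢⇒≡ᵇ-false : ∀ {m k} → m ≢ k → (m ≡ᵇ k) ≡ false
≢⇒≡ᵇ-false {m} {k} m≢k with m ≡ᵇ k in e
... | false = refl
... | true  = ⊥-elim (m≢k (≡ᵇ⇒≡ e))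

eqF⇒≡ : ∀ {n} {x y : Fin n} → eqF x y ≡ true → x ≡ y
eqF⇒≡ {x = x} {y} e with x Fin.≟ y
... | yes x≡y = x≡y

≢⇒eqF-false : ∀ {n} {x y : Fin n} → x ≢ y → eqF x y ≡ false
≢⇒eqF-false {x = x} {y} x≢y with x Fin.≟ y
... | yes x≡y = ⊥-elim (x≢y x≡y)
... | no _    = refl

eqF-refl : ∀ {n} (x : Fin n) → eqF x x ≡ true
eqF-refl x with x Fin.≟ x
... | yes _   = refl
... | no x≢x  = ⊥-elim (x≢x refl)

eqF-sym : ∀ {n} (x y : Fin n) → eqF x y ≡ eqF y x
eqF-sym x y with x Fin.≟ y
... | yes refl = sym (eqF-refl x)
... | no x≢y   = sym (≢⇒eqF-false (λ y≡x → x≢y (sym y≡x)))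

eqF-suc : ∀ {n} (x y : Fin n) → eqF (suc x) (suc y) ≡ eqF x y
eqF-suc x y with x Fin.≟ y
... | yes _ = refl
... | no _  = refl

sumFin≡sum : ∀ {n} (f : Fin n → ℚ) → sumFin f ≡ sum f
sumFin≡sum {zero}  f = refl
sumFin≡sum {suc n} f = cong (f zero +_) (sumFin≡sum (λ i → f (suc i)))

sumFin-cong : ∀ {n} {f g : Fin n → ℚ} → (∀ i → f i ≡ g i) → sumFin f ≡ sumFin g
sumFin-cong {zero}  eq = refl
sumFin-cong {suc n} eq = cong₂ _+_ (eq zero) (sumFin-cong (λ i → eq (suc i)))

sumFin-zero : ∀ n → sumFin {n} (λ _ → 0ℚ) ≡ 0ℚ
sumFin-zero n = trans (sumFin≡sum {n} _) (sum-replicate-zero n)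

sumFin-+ : ∀ {n} (f g : Fin n → ℚ) → sumFin (λ i → f i + g i) ≡ sumFin f + sumFin g
sumFin-+ f g = begin
  sumFin (λ i → f i + g i) ≡⟨ sumFin≡sum (λ i → f i + g i) ⟩
  sum (λ i → f i + g i)    ≡⟨ ∑-distrib-+ f g ⟩
  sum f + sum g            ≡⟨ cong₂ _+_ (sumFin≡sum f) (sumFin≡sum g) ⟨
  sumFin f + sumFin g      ∎

sumFin-*ˡ : ∀ {n} p (f : Fin n → ℚ) → sumFin (λ i → p * f i) ≡ p * sumFin f
sumFin-*ˡ p f = begin
  sumFin (λ i → p * f i) ≡⟨ sumFin≡sum (λ i → p * f i) ⟩
  sum (λ i → p * f i)    ≡⟨ *-distribˡ-sum p f ⟨
  p * sum f              ≡⟨ cong (p *_) (sumFin≡sum f) ⟨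
  p * sumFin f           ∎

sumFin-neg : ∀ {n} (f : Fin n → ℚ) → sumFin (λ i → - f i) ≡ - sumFin f
sumFin-neg {zero}  f = refl
sumFin-neg {suc n} f = trans (cong (- f zero +_) (sumFin-neg (λ i → f (suc i))))
                             (sym (neg-distrib-+ (f zero) _))

sumFin-comm : ∀ {m n} (f : Fin m → Fin n → ℚ) →
  sumFin (λ i → sumFin (f i)) ≡ sumFin (λ j → sumFin (λ i → f i j))
sumFin-comm f = begin
  sumFin (λ i → sumFin (f i))
    ≡⟨ trans (sumFin-cong (λ i → sumFin≡sum (f i))) (sumFin≡sum (λ i → sum (f i))) ⟩
  sum (λ i → sum (f i))
    ≡⟨ ∑-comm f ⟩
  sum (λ j → sum (λ i → f i j))
    ≡⟨ trans (sumFin-cong (λ j → sumFin≡sum (λ i → f i j)))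
             (sumFin≡sum (λ j → sum (λ i → f i j))) ⟨
  sumFin (λ j → sumFin (λ i → f i j)) ∎

sumFin-if : ∀ {n} (p : Fin n → Bool) q →
  sumFin (λ i → if p i then q else 0ℚ) ≡ fromℕ (countFin p) * q
sumFin-if {zero}  p q = sym (*-zeroˡ q)
sumFin-if {suc n} p q with p zero
... | true  = begin
  q + sumFin (λ i → if p (suc i) then q else 0ℚ)
    ≡⟨ cong (q +_) (sumFin-if (λ i → p (suc i)) q) ⟩
  q + fromℕ k * q
    ≡⟨ solve 2 (λ q k → q :+ k :* q := (con 1ℚ :+ k) :* q) refl q (fromℕ k) ⟩
  (1ℚ + fromℕ k) * q
    ≡⟨ cong (_* q) (fromℕ-+ 1 k) ⟨
  fromℕ (1 ℕ.+ k) * q ∎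
  where k = countFin (λ i → p (suc i))
... | false = trans (+-identityˡ _) (sumFin-if (λ i → p (suc i)) q)

sumFin-δ : ∀ {n} (x : Fin n) p (f : Fin n → ℚ) → f x ≡ 0ℚ →
  sumFin (λ t → if eqF x t then p else f t) ≡ p + sumFin f
sumFin-δ {suc n} zero    p f fx≡0 =
  cong (p +_) (sym (trans (cong (_+ sumFin (λ t → f (suc t))) fx≡0) (+-identityˡ _)))
sumFin-δ {suc n} (suc x) p f fx≡0 = begin
  f zero + sumFin (λ t → if eqF (suc x) (suc t) then p else f (suc t))
    ≡⟨ cong (f zero +_) (sumFin-cong (λ t → cong (λ b → if b then p else f (suc t))
                                                (eqF-suc x t))) ⟩
  f zero + sumFin (λ t → if eqF x t then p else f (suc t))
    ≡⟨ cong (f zero +_) (sumFin-δ x p (λ t → f (suc t)) fx≡0) ⟩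
  f zero + (p + sumFin (λ t → f (suc t)))
    ≡⟨ solve 3 (λ a p s → a :+ (p :+ s) := p :+ (a :+ s)) refl (f zero) p _ ⟩
  p + (f zero + sumFin (λ t → f (suc t))) ∎

sumBelow≡sum : ∀ m (g : ℕ → ℚ) → sumBelow m g ≡ sum (λ (i : Fin m) → g (toℕ i))
sumBelow≡sum zero    g = refl
sumBelow≡sum (suc m) g = begin
  sumBelow m g + g m
    ≡⟨ cong₂ _+_ (sumBelow≡sum m g) (cong g (sym (Fin.toℕ-fromℕ m))) ⟩
  sum {m} (λ i → g (toℕ i)) + g (toℕ (Data.Fin.fromℕ m))
    ≡⟨ cong (_+ g (toℕ (Data.Fin.fromℕ m)))
            (sum-cong-≗ {m} (λ i → cong g (Fin.toℕ-inject₁ i))) ⟨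
  sum {m} (λ i → g (toℕ (inject₁ i))) + g (toℕ (Data.Fin.fromℕ m))
    ≡⟨ sum-init-last {m} (λ i → g (toℕ i)) ⟨
  sum {suc m} (λ i → g (toℕ i)) ∎

sumBelow-cong : ∀ m {f g : ℕ → ℚ} → (∀ i → i < m → f i ≡ g i) →
  sumBelow m f ≡ sumBelow m g
sumBelow-cong zero    eq = refl
sumBelow-cong (suc m) eq =
  cong₂ _+_ (sumBelow-cong m (λ i i<m → eq i (ℕ.m≤n⇒m≤1+n i<m))) (eq m ℕ.≤-refl)

sumBelow-+ : ∀ m (f g : ℕ → ℚ) → sumBelow m (λ i → f i + g i) ≡ sumBelow m f + sumBelow m g
sumBelow-+ m f g = begin
  sumBelow m (λ i → f i + g i)
    ≡⟨ sumBelow≡sum m (λ i → f i + g i) ⟩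
  sum {m} (λ i → f (toℕ i) + g (toℕ i))
    ≡⟨ ∑-distrib-+ {m} (λ i → f (toℕ i)) (λ i → g (toℕ i)) ⟩
  sum {m} (λ i → f (toℕ i)) + sum {m} (λ i → g (toℕ i))
    ≡⟨ cong₂ _+_ (sumBelow≡sum m f) (sumBelow≡sum m g) ⟨
  sumBelow m f + sumBelow m g ∎

sumBelow-*ˡ : ∀ m p (f : ℕ → ℚ) → sumBelow m (λ i → p * f i) ≡ p * sumBelow m f
sumBelow-*ˡ m p f = begin
  sumBelow m (λ i → p * f i)     ≡⟨ sumBelow≡sum m (λ i → p * f i) ⟩
  sum {m} (λ i → p * f (toℕ i))  ≡⟨ *-distribˡ-sum {m} p (λ i → f (toℕ i)) ⟨
  p * sum {m} (λ i → f (toℕ i))  ≡⟨ cong (p *_) (sumBelow≡sum m f) ⟨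
  p * sumBelow m f               ∎

sumFin-sumBelow-comm : ∀ {n} m (f : Fin n → ℕ → ℚ) →
  sumFin (λ x → sumBelow m (f x)) ≡ sumBelow m (λ i → sumFin (λ x → f x i))
sumFin-sumBelow-comm {n} m f = begin
  sumFin (λ x → sumBelow m (f x))
    ≡⟨ trans (sumFin-cong (λ x → sumBelow≡sum m (f x)))
             (sumFin≡sum (λ x → sum {m} (λ i → f x (toℕ i)))) ⟩
  sum {n} (λ x → sum {m} (λ i → f x (toℕ i)))
    ≡⟨ ∑-comm {n} {m} (λ x i → f x (toℕ i)) ⟩
  sum {m} (λ i → sum {n} (λ x → f x (toℕ i)))
    ≡⟨ trans (sumBelow≡sum m (λ i → sumFin (λ x → f x i)))
             (sum-cong-≗ {m} (λ i → sumFin≡sum (λ x → f x (toℕ i)))) ⟨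
  sumBelow m (λ i → sumFin (λ x → f x i)) ∎

sumBelow-comm : ∀ m k (f : ℕ → ℕ → ℚ) →
  sumBelow m (λ i → sumBelow k (f i)) ≡ sumBelow k (λ j → sumBelow m (λ i → f i j))
sumBelow-comm m k f = begin
  sumBelow m (λ i → sumBelow k (f i))
    ≡⟨ trans (sumBelow-cong m (λ i _ → sumBelow≡sum k (f i)))
             (sumBelow≡sum m (λ i → sum {k} (λ j → f i (toℕ j)))) ⟩
  sum {m} (λ i → sum {k} (λ j → f (toℕ i) (toℕ j)))
    ≡⟨ ∑-comm {m} {k} (λ i j → f (toℕ i) (toℕ j)) ⟩
  sum {k} (λ j → sum {m} (λ i → f (toℕ i) (toℕ j)))
    ≡⟨ trans (sumBelow-cong k (λ j _ → sumBelow≡sum m (λ i → f i j)))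
             (sumBelow≡sum k (λ j → sum {m} (λ i → f (toℕ i) j))) ⟨
  sumBelow k (λ j → sumBelow m (λ i → f i j)) ∎

fromℕ-sumBelowℕ : ∀ m (g : ℕ → ℕ) → fromℕ (sumBelowℕ m g) ≡ sumBelow m (λ i → fromℕ (g i))
fromℕ-sumBelowℕ zero    g = refl
fromℕ-sumBelowℕ (suc m) g =
  trans (fromℕ-+ (sumBelowℕ m g) (g m)) (cong (_+ fromℕ (g m)) (fromℕ-sumBelowℕ m g))

<ᵇ-true : ∀ {m k} → m < k → (m <ᵇ k) ≡ true
<ᵇ-true m<k = Equivalence.to T-≡ (ℕ.<⇒<ᵇ m<k)

<ᵇ-false : ∀ {m k} → k ≤ m → (m <ᵇ k) ≡ false
<ᵇ-false {m} {k} k≤m = ¬T⇒≡false (λ t → ℕ.<⇒≱ (ℕ.<ᵇ⇒< m k t) k≤m)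

≤ᵇ-true : ∀ {m k} → m ≤ k → (m ≤ᵇ k) ≡ true
≤ᵇ-true m≤k = Equivalence.to T-≡ (ℕ.≤⇒≤ᵇ m≤k)

≤ᵇ-false : ∀ {m k} → k < m → (m ≤ᵇ k) ≡ false
≤ᵇ-false {m} {k} k<m = ¬T⇒≡false (λ t → ℕ.<⇒≱ k<m (ℕ.≤ᵇ⇒≤ m k t))

sumBelow-δ : ∀ m d (h : ℕ → ℚ) →
  sumBelow m (λ i → if d ≡ᵇ i then h i else 0ℚ) ≡ (if d <ᵇ m then h d else 0ℚ)
sumBelow-δ zero    d h = refl
sumBelow-δ (suc m) d h =
  trans (cong (_+ (if d ≡ᵇ m then h m else 0ℚ)) (sumBelow-δ m d h)) (last-term (ℕ.<-cmp d m))
  where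
  last-term : Tri (d < m) (d ≡ m) (m < d) →
    (if d <ᵇ m then h d else 0ℚ) + (if d ≡ᵇ m then h m else 0ℚ) ≡
    (if d <ᵇ suc m then h d else 0ℚ)
  last-term (tri< d<m d≢m _)
    rewrite <ᵇ-true d<m | ≢⇒≡ᵇ-false d≢m | <ᵇ-true (ℕ.m≤n⇒m≤1+n d<m) = +-identityʳ (h d)
  last-term (tri≈ _ refl _)
    rewrite <ᵇ-false (ℕ.≤-refl {d}) | ≡ᵇ-refl d | <ᵇ-true (ℕ.n<1+n d) = +-identityˡ (h d)
  last-term (tri> _ d≢m m<d)
    rewrite <ᵇ-false (ℕ.<⇒≤ m<d) | ≢⇒≡ᵇ-false d≢m | <ᵇ-false m<d = +-identityʳ 0ℚ

sumRange-snoc : ∀ a D (f : ℕ → ℚ) →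
  sumRange a (suc D) f ≡ sumRange a D f + (if a ≤ᵇ suc D then f (suc D) else 0ℚ)
sumRange-snoc a D f with a ℕ.≤? suc D
... | yes a≤1+D = begin
  sumBelow (suc (suc D) ∸ a) (λ t → f (a ℕ.+ t))
    ≡⟨ cong (λ m → sumBelow m (λ t → f (a ℕ.+ t))) (ℕ.+-∸-assoc 1 a≤1+D) ⟩
  sumRange a D f + f (a ℕ.+ (suc D ∸ a))
    ≡⟨ cong (λ j → sumRange a D f + f j) (ℕ.m+[n∸m]≡n a≤1+D) ⟩
  sumRange a D f + f (suc D)
    ≡⟨ cong (λ b → sumRange a D f + (if b then f (suc D) else 0ℚ)) (≤ᵇ-true a≤1+D) ⟨
  sumRange a D f + (if a ≤ᵇ suc D then f (suc D) else 0ℚ) ∎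
... | no a≰1+D = begin
  sumBelow (suc (suc D) ∸ a) (λ t → f (a ℕ.+ t))
    ≡⟨ cong (λ m → sumBelow m (λ t → f (a ℕ.+ t)))
            (trans (ℕ.m≤n⇒m∸n≡0 1+D<a) (sym (ℕ.m≤n⇒m∸n≡0 (ℕ.<⇒≤ 1+D<a)))) ⟩
  sumRange a D f
    ≡⟨ +-identityʳ (sumRange a D f) ⟨
  sumRange a D f + 0ℚ
    ≡⟨ cong (λ b → sumRange a D f + (if b then f (suc D) else 0ℚ)) (≤ᵇ-false 1+D<a) ⟨
  sumRange a D f + (if a ≤ᵇ suc D then f (suc D) else 0ℚ) ∎
  where
  1+D<a : suc D < a
  1+D<a = ℕ.≰⇒> a≰1+D

sumRange-indicator : ∀ a D (f : ℕ → ℚ) →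
  sumRange a D f ≡ sumBelow (suc D) (λ j → if a ≤ᵇ j then f j else 0ℚ)
sumRange-indicator zero    zero    f = refl
sumRange-indicator (suc a) zero    f rewrite ℕ.0∸n≡0 a = sym (+-identityʳ 0ℚ)
sumRange-indicator a       (suc D) f =
  trans (sumRange-snoc a D f)
        (cong (_+ (if a ≤ᵇ suc D then f (suc D) else 0ℚ)) (sumRange-indicator a D f))

sumBelow-peel : ∀ m (h : ℕ → ℚ) → sumBelow (suc m) h ≡ h 0 + sumBelow m (λ t → h (suc t))
sumBelow-peel zero    h = trans (+-identityˡ (h 0)) (sym (+-identityʳ (h 0)))
sumBelow-peel (suc m) h = trans (cong (_+ h (suc m)) (sumBelow-peel m h)) (+-assoc (h 0) _ (h (suc m)))

sumRange-suc : ∀ i D (f : ℕ → ℚ) →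
  sumRange (suc i) D f ≡ (if suc i ≤ᵇ D then f (suc i) else 0ℚ) + sumRange (suc (suc i)) D f
sumRange-suc i D f with suc i ℕ.≤? D
... | yes i<D = begin
  sumBelow (D ∸ i) (λ t → f (suc (i ℕ.+ t)))
    ≡⟨ cong (λ m → sumBelow m (λ t → f (suc (i ℕ.+ t)))) (ℕ.+-∸-assoc 1 i<D) ⟩
  sumBelow (suc (D ∸ suc i)) (λ t → f (suc (i ℕ.+ t)))
    ≡⟨ sumBelow-peel (D ∸ suc i) (λ t → f (suc (i ℕ.+ t))) ⟩
  f (suc (i ℕ.+ 0)) + sumBelow (D ∸ suc i) (λ t → f (suc (i ℕ.+ suc t)))
    ≡⟨ cong₂ _+_ (cong (λ m → f (suc m)) (ℕ.+-identityʳ i))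
                 (sumBelow-cong (D ∸ suc i) (λ t _ → cong (λ m → f (suc m)) (ℕ.+-suc i t))) ⟩
  f (suc i) + sumBelow (D ∸ suc i) (λ t → f (suc (suc (i ℕ.+ t))))
    ≡⟨ cong (λ b → (if b then f (suc i) else 0ℚ) + sumRange (suc (suc i)) D f) (≤ᵇ-true i<D) ⟨
  (if suc i ≤ᵇ D then f (suc i) else 0ℚ) + sumRange (suc (suc i)) D f ∎
... | no i≮D = begin
  sumBelow (D ∸ i) (λ t → f (suc (i ℕ.+ t)))
    ≡⟨ cong (λ m → sumBelow m (λ t → f (suc (i ℕ.+ t)))) (ℕ.m≤n⇒m∸n≡0 D≤i) ⟩
  0ℚ + 0ℚ
    ≡⟨ cong₂ _+_ (cong (λ b → if b then f (suc i) else 0ℚ) (≤ᵇ-false (s≤s D≤i)))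
                 (cong (λ m → sumBelow m (λ t → f (suc (suc (i ℕ.+ t)))))
                       (ℕ.m≤n⇒m∸n≡0 (ℕ.m≤n⇒m≤1+n D≤i))) ⟨
  (if suc i ≤ᵇ D then f (suc i) else 0ℚ) + sumRange (suc (suc i)) D f ∎
  where
  D≤i : D ≤ i
  D≤i = ℕ.≤-pred (ℕ.≰⇒> i≮D)

sumBelow-truncate : ∀ M j (f : ℕ → ℚ) → j ≤ M →
  sumBelow M (λ i → if suc i ≤ᵇ j then f i else 0ℚ) ≡ sumBelow j f
sumBelow-truncate zero    zero f _ = refl
sumBelow-truncate (suc M) j    f j≤1+M with ℕ.m≤n⇒m<n∨m≡n j≤1+M
... | inj₁ j<1+M = begin
  sumBelow M (λ i → if suc i ≤ᵇ j then f i else 0ℚ) + (if suc M ≤ᵇ j then f M else 0ℚ)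
    ≡⟨ cong₂ _+_ (sumBelow-truncate M j f (ℕ.≤-pred j<1+M))
                 (cong (λ b → if b then f M else 0ℚ) (≤ᵇ-false j<1+M)) ⟩
  sumBelow j f + 0ℚ ≡⟨ +-identityʳ _ ⟩
  sumBelow j f      ∎
... | inj₂ refl = cong₂ _+_
  (sumBelow-cong M (λ i i<M → cong (λ b → if b then f i else 0ℚ) (≤ᵇ-true (ℕ.m≤n⇒m≤1+n i<M))))
  (cong (λ b → if b then f M else 0ℚ) (≤ᵇ-true (ℕ.≤-refl {suc M})))

sumFin-one : ∀ n → sumFin {n} (λ _ → 1ℚ) ≡ fromℕ n
sumFin-one zero    = refl
sumFin-one (suc n) = trans (cong (1ℚ +_) (sumFin-one n)) (sym (fromℕ-+ 1 n))

sumFin-by-level : ∀ {n} (level : Fin n → ℕ) M (h : ℕ → ℚ) → (∀ x → level x < M) →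
  sumFin (λ x → h (level x)) ≡ sumBelow M (λ i → fromℕ (countFin (λ x → level x ≡ᵇ i)) * h i)
sumFin-by-level level M h level<M = begin
  sumFin (λ x → h (level x))
    ≡⟨ sumFin-cong (λ x → sym (trans (sumBelow-δ M (level x) h)
                                     (cong (λ b → if b then h (level x) else 0ℚ) (<ᵇ-true (level<M x))))) ⟩
  sumFin (λ x → sumBelow M (λ i → if level x ≡ᵇ i then h i else 0ℚ))
    ≡⟨ sumFin-sumBelow-comm M (λ x i → if level x ≡ᵇ i then h i else 0ℚ) ⟩
  sumBelow M (λ i → sumFin (λ x → if level x ≡ᵇ i then h i else 0ℚ))
    ≡⟨ sumBelow-cong M (λ i _ → sumFin-if (λ x → level x ≡ᵇ i) (h i)) ⟩
  sumBelow M (λ i → fromℕ (countFin (λ x → level x ≡ᵇ i)) * h i) ∎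

sumBelow-sumRange : ∀ D (w f : ℕ → ℚ) →
  sumBelow (suc D) (λ i → w i * sumRange (suc i) D f) ≡ sumRange 1 D (λ j → sumBelow j w * f j)
sumBelow-sumRange D w f = begin
  sumBelow (suc D) (λ i → w i * sumRange (suc i) D f)
    ≡⟨ sumBelow-cong (suc D) (λ i _ → trans (cong (w i *_) (sumRange-indicator (suc i) D f))
         (trans (sym (sumBelow-*ˡ (suc D) (w i) _))
                (sumBelow-cong (suc D) (λ j _ → *-if (suc i ≤ᵇ j) (w i) (f j))))) ⟩
  sumBelow (suc D) (λ i → sumBelow (suc D) (λ j → (if suc i ≤ᵇ j then w i else 0ℚ) * f j))
    ≡⟨ sumBelow-comm (suc D) (suc D) (λ i j → (if suc i ≤ᵇ j then w i else 0ℚ) * f j) ⟩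
  sumBelow (suc D) (λ j → sumBelow (suc D) (λ i → (if suc i ≤ᵇ j then w i else 0ℚ) * f j))
    ≡⟨ sumBelow-cong (suc D) (λ j j≤D → begin
         sumBelow (suc D) (λ i → (if suc i ≤ᵇ j then w i else 0ℚ) * f j)
           ≡⟨ trans (sumBelow-cong (suc D) (λ i _ → *-comm _ (f j))) (sumBelow-*ˡ (suc D) (f j) _) ⟩
         f j * sumBelow (suc D) (λ i → if suc i ≤ᵇ j then w i else 0ℚ)
           ≡⟨ cong (f j *_) (sumBelow-truncate (suc D) j w (ℕ.<⇒≤ j≤D)) ⟩
         f j * sumBelow j w
           ≡⟨ trans (*-comm (f j) _) (from-one j) ⟩
         (if 1 ≤ᵇ j then sumBelow j w * f j else 0ℚ) ∎) ⟩
  sumBelow (suc D) (λ j → if 1 ≤ᵇ j then sumBelow j w * f j else 0ℚ)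
    ≡⟨ sumRange-indicator 1 D (λ j → sumBelow j w * f j) ⟨
  sumRange 1 D (λ j → sumBelow j w * f j) ∎
  where
  *-if : ∀ (b : Bool) p q → p * (if b then q else 0ℚ) ≡ (if b then p else 0ℚ) * q
  *-if true  p q = refl
  *-if false p q = trans (*-zeroʳ p) (sym (*-zeroˡ q))
  from-one : ∀ j → sumBelow j w * f j ≡ (if 1 ≤ᵇ j then sumBelow j w * f j else 0ℚ)
  from-one zero    = *-zeroˡ (f 0)
  from-one (suc j) = refl

countFin-cong : ∀ {n} {p q : Fin n → Bool} → (∀ t → p t ≡ q t) → countFin p ≡ countFin q
countFin-cong {zero}  eq = refl
countFin-cong {suc n} eq =
  cong₂ (λ b k → (if b then 1 else 0) ℕ.+ k) (eq zero) (countFin-cong (λ t → eq (suc t)))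

countFin-≤ : ∀ {n} (p : Fin n → Bool) → countFin p ≤ n
countFin-≤ {zero}  p = z≤n
countFin-≤ {suc n} p with p zero
... | true  = s≤s (countFin-≤ (λ i → p (suc i)))
... | false = ℕ.m≤n⇒m≤1+n (countFin-≤ (λ i → p (suc i)))

countFin-mono : ∀ {n} (p q : Fin n → Bool) → (∀ t → p t ≡ true → q t ≡ true) →
  countFin p ≤ countFin q
countFin-mono {zero}  p q p⊆q = z≤n
countFin-mono {suc n} p q p⊆q with p zero in p0 | q zero in q0
... | true  | true  = s≤s (countFin-mono _ _ (λ t → p⊆q (suc t)))
... | true  | false = ⊥-elim (true≢false (trans (sym (p⊆q zero p0)) q0))
... | false | true  = ℕ.m≤n⇒m≤1+n (countFin-mono _ _ (λ t → p⊆q (suc t)))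
... | false | false = countFin-mono _ _ (λ t → p⊆q (suc t))

countFin-strict : ∀ {n} (p q : Fin n → Bool) → (∀ t → p t ≡ true → q t ≡ true) →
  ∀ t → q t ≡ true → p t ≡ false → countFin p < countFin q
countFin-strict {suc n} p q p⊆q zero    qt pt rewrite qt | pt =
  s≤s (countFin-mono _ _ (λ t → p⊆q (suc t)))
countFin-strict {suc n} p q p⊆q (suc t) qt pt with p zero in p0 | q zero in q0
... | true  | true  = s≤s (countFin-strict _ _ (λ t → p⊆q (suc t)) t qt pt)
... | true  | false = ⊥-elim (true≢false (trans (sym (p⊆q zero p0)) q0))
... | false | true  = ℕ.m≤n⇒m≤1+n (countFin-strict _ _ (λ t → p⊆q (suc t)) t qt pt)
... | false | false = countFin-strict _ _ (λ t → p⊆q (suc t)) t qt pt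

countFin-pos : ∀ {n} (p : Fin n → Bool) t → p t ≡ true → 1 ≤ countFin p
countFin-pos p t pt = ℕ.≤-trans (s≤s z≤n) (countFin-strict (λ _ → false) p (λ _ ()) t pt refl)

countFin-full : ∀ {n} (p : Fin n → Bool) → n ≤ countFin p → ∀ t → p t ≡ true
countFin-full {suc n} p n≤ t with p zero in p0
countFin-full {suc n} p n≤        zero    | true  = p0
countFin-full {suc n} p (s≤s n≤)  (suc t) | true  = countFin-full (λ i → p (suc i)) n≤ t
countFin-full {suc n} p n≤        t       | false =
  ⊥-elim (ℕ.<-irrefl refl (ℕ.≤-trans n≤ (countFin-≤ (λ i → p (suc i)))))

countFin≡0 : ∀ {n} (p : Fin n → Bool) → countFin p ≡ 0 → ∀ t → p t ≡ false
countFin≡0 p count≡0 t with p t in pt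
... | false = refl
... | true  = ⊥-elim (ℕ.<-irrefl refl (subst (1 ≤_) count≡0 (countFin-pos p t pt)))

countFin-witness : ∀ {n} (p : Fin n → Bool) {m} → countFin p ≡ suc m → ∃ λ t → p t ≡ true
countFin-witness {suc n} p count≡ with p zero in p0
... | true  = zero , p0
... | false = let (t , pt) = countFin-witness (λ i → p (suc i)) count≡ in suc t , pt

countFin-eqF : ∀ {n} (y : Fin n) → countFin (eqF y) ≡ 1
countFin-eqF {suc n} zero    = cong suc (countFin-none (λ i → eqF {suc n} zero (suc i)) (λ _ → refl))
  where
  countFin-none : ∀ {m} (p : Fin m → Bool) → (∀ t → p t ≡ false) → countFin p ≡ 0
  countFin-none {zero}  p none = refl
  countFin-none {suc m} p none rewrite none zero = countFin-none (λ i → p (suc i)) (λ t → none (suc t))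
countFin-eqF {suc n} (suc y) = trans (countFin-cong (eqF-suc y)) (countFin-eqF y)

anyFin-witness : ∀ {n} (p : Fin n → Bool) → anyFin p ≡ true → ∃ λ t → p t ≡ true
anyFin-witness {suc n} p any with p zero in p0
... | true  = zero , p0
... | false = let (t , pt) = anyFin-witness (λ i → p (suc i)) any in suc t , pt

anyFin-intro : ∀ {n} (p : Fin n → Bool) t → p t ≡ true → anyFin p ≡ true
anyFin-intro p zero    pt rewrite pt = refl
anyFin-intro p (suc t) pt =
  trans (cong (p zero ∨_) (anyFin-intro (λ i → p (suc i)) t pt)) (∨-zeroʳ (p zero))

anyFin-false : ∀ {n} (p : Fin n → Bool) → anyFin p ≡ false → ∀ t → p t ≡ false
anyFin-false p none t with p t in pt
... | false = refl
... | true  = ⊥-elim (true≢false (trans (sym (anyFin-intro p t pt)) none))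

maxFin-≥ : ∀ {n} (f : Fin n → ℕ) t → f t ≤ maxFin f
maxFin-≥ f zero    = ℕ.m≤m⊔n (f zero) _
maxFin-≥ f (suc t) = ℕ.≤-trans (maxFin-≥ (λ i → f (suc i)) t) (ℕ.m≤n⊔m (f zero) _)

least-≤ : ∀ fuel (p : ℕ → Bool) j → p j ≡ true → least fuel p ≤ j
least-≤ zero       p j       pj = z≤n
least-≤ (suc fuel) p j       pj with p 0 in p0
... | true = z≤n
least-≤ (suc fuel) p zero    pj | false = ⊥-elim (true≢false (trans (sym pj) p0))
least-≤ (suc fuel) p (suc j) pj | false = s≤s (least-≤ fuel (λ i → p (suc i)) j pj)

least-holds : ∀ fuel (p : ℕ → Bool) j → p j ≡ true → j < fuel → p (least fuel p) ≡ true
least-holds (suc fuel) p j       pj j<fuel with p 0 in p0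
... | true = p0
least-holds (suc fuel) p zero    pj j<fuel       | false = ⊥-elim (true≢false (trans (sym pj) p0))
least-holds (suc fuel) p (suc j) pj (s≤s j<fuel) | false = least-holds fuel (λ i → p (suc i)) j pj j<fuel

-- Walks and graph distance

module Distance {n : ℕ} (G : SimpleGraph n) where
  open SimpleGraph G

  -- A record rather than `reach G i x y ≡ true`, so that `reach` is not unfolded during unification.
  record Reach (i : ℕ) (x y : Fin n) : Set where
    constructor reach⁺
    field reach⁻ : reach G i x y ≡ true
  open Reach

  reach-suc : ∀ {i x y} → Reach i x y → Reach (suc i) x y
  reach-suc {i} {x} (reach⁺ r) = reach⁺ (cong (_∨ anyFin (λ z → reach G i x z ∧ adj z _)) r)

  reach-snoc : ∀ {i x y} z → Reach i x z → adj z y ≡ true → Reach (suc i) x y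
  reach-snoc {i} {x} {y} z (reach⁺ r) z~y = reach⁺
    (trans (cong (reach G i x y ∨_)
                 (anyFin-intro (λ w → reach G i x w ∧ adj w y) z (cong₂ _∧_ r z~y)))
           (∨-zeroʳ _))

  reach-suc-inv : ∀ {i x y} → Reach (suc i) x y →
    Reach i x y ⊎ ∃ λ z → Reach i x z × adj z y ≡ true
  reach-suc-inv {i} {x} {y} (reach⁺ r) with reach G i x y in r₀
  ... | true  = inj₁ (reach⁺ r₀)
  ... | false =
    let (z , rz) = anyFin-witness (λ w → reach G i x w ∧ adj w y) r
    in  inj₂ (z , reach⁺ (∧-true₁ rz) , ∧-true₂ rz)
    where
    ∧-true₁ : ∀ {a b} → a ∧ b ≡ true → a ≡ true
    ∧-true₁ {true} _ = refl
    ∧-true₂ : ∀ {a b} → a ∧ b ≡ true → b ≡ true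
    ∧-true₂ {true} ab = ab

  reach-mono : ∀ {i j x y} → i ≤ j → Reach i x y → Reach j x y
  reach-mono {i} {j} {x} {y} i≤j r = subst (λ m → Reach m x y) (ℕ.m∸n+n≡m i≤j) (go (j ∸ i) r)
    where
    go : ∀ k → Reach i x y → Reach (k ℕ.+ i) x y
    go zero    r = r
    go (suc k) r = reach-suc (go k r)

  reach-zero : ∀ {x y} → Reach 0 x y → x ≡ y
  reach-zero (reach⁺ r) = eqF⇒≡ r

  reach-refl : ∀ {i} x → Reach i x x
  reach-refl x = reach-mono z≤n (reach⁺ (eqF-refl x))

  reach-cons : ∀ {i x z y} → adj x z ≡ true → Reach i z y → Reach (suc i) x y
  reach-cons {zero}  {x} x~z r with reach-zero r
  ... | refl = reach-snoc x (reach-refl x) x~z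
  reach-cons {suc i}     x~z r with reach-suc-inv r
  ... | inj₁ r′             = reach-suc (reach-cons x~z r′)
  ... | inj₂ (w , r′ , w~y) = reach-snoc w (reach-cons x~z r′) w~y

  reach-sym : ∀ {i x y} → Reach i x y → Reach i y x
  reach-sym {zero}  {x}     r with reach-zero r
  ... | refl = reach-refl x
  reach-sym {suc i} {x} {y} r with reach-suc-inv r
  ... | inj₁ r′             = reach-suc (reach-sym r′)
  ... | inj₂ (z , r′ , z~y) = reach-cons (trans (symm y z) z~y) (reach-sym r′)

  reach-stable : ∀ {i x} → (∀ y → Reach (suc i) x y → Reach i x y) →
    ∀ j y → Reach j x y → Reach i x y
  reach-stable stable zero    y r = reach-mono z≤n r
  reach-stable stable (suc j) y r with reach-suc-inv r
  ... | inj₁ r′             = reach-stable stable j y r′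
  ... | inj₂ (z , r′ , z~y) = stable y (reach-snoc z (reach-stable stable j z r′) z~y)

  dist-minimal : ∀ {j x y} → Reach j x y → dist G x y ≤ j
  dist-minimal {j} {x} {y} (reach⁺ r) = least-≤ n (λ i → reach G i x y) j r

  dist-refl : ∀ x → dist G x x ≡ 0
  dist-refl x = ℕ.n≤0⇒n≡0 (dist-minimal (reach-refl {0} x))

  module WhenConnected (conn : Connected G) where

    -- A ball that stops growing is closed under adjacency, hence everything by connectivity.
    reach-grows : ∀ x i → (∀ y → Reach i x y) ⊎ suc i ≤ countFin (reach G i x)
    reach-grows x zero    = inj₂ (countFin-pos (reach G 0 x) x (eqF-refl x))
    reach-grows x (suc i) with reach-grows x i
    ... | inj₁ all        = inj₁ (λ y → reach-suc (all y))
    ... | inj₂ i<count with anyFin (λ y → reach G (suc i) x y ∧ not (reach G i x y)) in new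
    ...   | true  =
      let (y , ry) = anyFin-witness (λ y → reach G (suc i) x y ∧ not (reach G i x y)) new
      in  inj₂ (ℕ.≤-trans (s≤s i<count)
            (countFin-strict (reach G i x) (reach G (suc i) x)
                             (λ t r → reach⁻ (reach-suc {i} {x} {t} (reach⁺ r))) y (∧-not₁ ry) (∧-not₂ ry)))
      where
      ∧-not₁ : ∀ {a b} → a ∧ not b ≡ true → a ≡ true
      ∧-not₁ {true} _ = refl
      ∧-not₂ : ∀ {a b} → a ∧ not b ≡ true → b ≡ false
      ∧-not₂ {true} {false} _ = refl
    ...   | false =
      inj₁ (λ y → reach-suc (reach-stable stable (proj₁ (conn x y)) y (reach⁺ (proj₂ (conn x y)))))
      where
      stable : ∀ y → Reach (suc i) x y → Reach i x y
      stable y (reach⁺ r) = reach⁺ (old r (anyFin-false _ new y))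
        where
        old : ∀ {a b} → a ≡ true → a ∧ not b ≡ false → b ≡ true
        old {true} {true} _ _ = refl

    reach-all : ∀ x y → Reach (n ∸ 1) x y
    reach-all x y with reach-grows x (n ∸ 1)
    ... | inj₁ all = all y
    ... | inj₂ n≤count = reach⁺ (countFin-full (reach G (n ∸ 1) x)
                                  (subst (_≤ countFin (reach G (n ∸ 1) x)) (suc-pred x) n≤count) y)
      where
      suc-pred : ∀ {m} → Fin m → suc (m ∸ 1) ≡ m
      suc-pred {suc m} _ = refl

    dist-reach : ∀ x y → Reach (dist G x y) x y
    dist-reach x y =
      reach⁺ (least-holds n (λ i → reach G i x y) (n ∸ 1) (reach⁻ (reach-all x y)) (pred< x))
      where
      pred< : ∀ {m} → Fin m → m ∸ 1 < m
      pred< {suc m} _ = ℕ.≤-refl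

    dist-sym : ∀ x y → dist G x y ≡ dist G y x
    dist-sym x y = ℕ.≤-antisym (dist-minimal (reach-sym (dist-reach y x)))
                               (dist-minimal (reach-sym (dist-reach x y)))

    dist≡0⇒≡ : ∀ {x y} → dist G x y ≡ 0 → x ≡ y
    dist≡0⇒≡ {x} {y} d≡0 = reach-zero (subst (λ m → Reach m x y) d≡0 (dist-reach x y))

    adj⇒dist≡1 : ∀ {x t} → adj x t ≡ true → dist G x t ≡ 1
    adj⇒dist≡1 {x} {t} x~t with dist G x t in d | dist-minimal {1} {x} {t} (reach-snoc x (reach-refl x) x~t)
    ... | zero        | _       =
      ⊥-elim (true≢false (trans (sym x~t) (subst (λ w → adj x w ≡ false) (dist≡0⇒≡ d) (irrefl x))))
    ... | suc zero    | _       = refl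
    ... | suc (suc _) | s≤s ()

    dist≡1⇒adj : ∀ {x t} → dist G x t ≡ 1 → adj x t ≡ true
    dist≡1⇒adj {x} {t} d≡1 with reach-suc-inv (subst (λ m → Reach m x t) d≡1 (dist-reach x t))
    ... | inj₁ r             =
      ⊥-elim (ℕ.0≢1+n (trans (sym (dist-refl x)) (subst (λ w → dist G x w ≡ 1) (sym (reach-zero r)) d≡1)))
    ... | inj₂ (z , r , z~t) = subst (λ w → adj w t ≡ true) (sym (reach-zero r)) z~t

    dist≡ᵇ1≡adj : ∀ x t → (dist G x t ≡ᵇ 1) ≡ adj x t
    dist≡ᵇ1≡adj x t with adj x t in x~t
    ... | true  rewrite adj⇒dist≡1 x~t = refl
    ... | false = ≢⇒≡ᵇ-false (λ d≡1 → true≢false (trans (sym (dist≡1⇒adj d≡1)) x~t))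

    dist-adj-≤ : ∀ {y t w} → adj t w ≡ true → dist G y w ≤ suc (dist G y t)
    dist-adj-≤ {y} {t} t~w = dist-minimal (reach-snoc t (dist-reach y t) t~w)

    dist-predecessor : ∀ {y w i} → dist G y w ≡ suc i → ∃ λ t → adj t w ≡ true × dist G y t ≡ i
    dist-predecessor {y} {w} {i} d≡ with reach-suc-inv (subst (λ m → Reach m y w) d≡ (dist-reach y w))
    ... | inj₁ r             = ⊥-elim (ℕ.<-irrefl refl (ℕ.≤-trans (ℕ.≤-reflexive (sym d≡)) (dist-minimal r)))
    ... | inj₂ (t , r , t~w) =
      t , t~w , ℕ.≤-antisym (dist-minimal r) (ℕ.≤-pred (subst (_≤ suc (dist G y t)) d≡ (dist-adj-≤ t~w)))

-- Uniqueness of the group inverse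

module _ {n : ℕ} where

  ≐-sym : {A B : Matrix n} → A ≐ B → B ≐ A
  ≐-sym A≐B i j = sym (A≐B i j)

  ≐-trans : {A B C : Matrix n} → A ≐ B → B ≐ C → A ≐ C
  ≐-trans A≐B B≐C i j = trans (A≐B i j) (B≐C i j)

  ⊗-cong : {A A′ B B′ : Matrix n} → A ≐ A′ → B ≐ B′ → (A ⊗ B) ≐ (A′ ⊗ B′)
  ⊗-cong A≐A′ B≐B′ i j = sumFin-cong (λ t → cong₂ _*_ (A≐A′ i t) (B≐B′ t j))

  ⊗-congˡ : {A A′ : Matrix n} (B : Matrix n) → A ≐ A′ → (A ⊗ B) ≐ (A′ ⊗ B)
  ⊗-congˡ B A≐A′ = ⊗-cong {B = B} {B} A≐A′ (λ _ _ → refl)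

  ⊗-congʳ : (A : Matrix n) {B B′ : Matrix n} → B ≐ B′ → (A ⊗ B) ≐ (A ⊗ B′)
  ⊗-congʳ A B≐B′ = ⊗-cong {A} {A} (λ _ _ → refl) B≐B′

  ⊗-assoc : (A B C : Matrix n) → ((A ⊗ B) ⊗ C) ≐ (A ⊗ (B ⊗ C))
  ⊗-assoc A B C i j = begin
    sumFin (λ t → sumFin (λ s → A i s * B s t) * C t j)
      ≡⟨ sumFin-cong (λ t → trans (*-comm _ (C t j)) (sym (sumFin-*ˡ (C t j) (λ s → A i s * B s t)))) ⟩
    sumFin (λ t → sumFin (λ s → C t j * (A i s * B s t)))
      ≡⟨ sumFin-cong (λ t → sumFin-cong (λ s →
           solve 3 (λ c a b → c :* (a :* b) := a :* (b :* c)) refl (C t j) (A i s) (B s t))) ⟩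
    sumFin (λ t → sumFin (λ s → A i s * (B s t * C t j)))
      ≡⟨ sumFin-comm (λ t s → A i s * (B s t * C t j)) ⟩
    sumFin (λ s → sumFin (λ t → A i s * (B s t * C t j)))
      ≡⟨ sumFin-cong (λ s → sumFin-*ˡ (A i s) (λ t → B s t * C t j)) ⟩
    sumFin (λ s → A i s * sumFin (λ t → B s t * C t j)) ∎

  centring : ℚ → Matrix n
  centring c i j = (if eqF i j then 1ℚ else 0ℚ) - c

  RowSumsZero ColSumsZero : Matrix n → Set
  RowSumsZero M = ∀ i → sumFin (M i) ≡ 0ℚ
  ColSumsZero M = ∀ j → sumFin (λ i → M i j) ≡ 0ℚ

  private
    *-δ-minus : ∀ u (b : Bool) c → u * ((if b then 1ℚ else 0ℚ) - c) ≡ (if b then u else 0ℚ) - c * u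
    *-δ-minus u true  c = solve 2 (λ u c → u :* (con 1ℚ :- c) := u :- c :* u) refl u c
    *-δ-minus u false c = solve 2 (λ u c → u :* (con 0ℚ :- c) := con 0ℚ :- c :* u) refl u c

    if-eqF-at : ∀ (x t : Fin n) (f : Fin n → ℚ) →
      (if eqF x t then f t else 0ℚ) ≡ (if eqF x t then f x else 0ℚ)
    if-eqF-at x t f with eqF x t in x≟t
    ... | true  = cong f (sym (eqF⇒≡ x≟t))
    ... | false = refl

    sumFin-δ-minus : ∀ (x : Fin n) a c (g : Fin n → ℚ) → sumFin g ≡ 0ℚ →
      sumFin (λ t → (if eqF x t then a else 0ℚ) - c * g t) ≡ a
    sumFin-δ-minus x a c g Σg≡0 = begin
      sumFin (λ t → (if eqF x t then a else 0ℚ) - c * g t)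
        ≡⟨ sumFin-+ (λ t → if eqF x t then a else 0ℚ) (λ t → - (c * g t)) ⟩
      sumFin (λ t → if eqF x t then a else 0ℚ) + sumFin (λ t → - (c * g t))
        ≡⟨ cong₂ _+_ (sumFin-δ x a (λ _ → 0ℚ) refl)
                     (trans (sumFin-neg (λ t → c * g t)) (cong -_ (sumFin-*ˡ c g))) ⟩
      (a + sumFin {n} (λ _ → 0ℚ)) - c * sumFin g
        ≡⟨ cong₂ (λ z w → (a + z) - c * w) (sumFin-zero n) Σg≡0 ⟩
      (a + 0ℚ) - c * 0ℚ
        ≡⟨ solve 2 (λ a c → (a :+ con 0ℚ) :- c :* con 0ℚ := a) refl a c ⟩
      a ∎

  ⊗-centring : ∀ c (M : Matrix n) → RowSumsZero M → (M ⊗ centring c) ≐ M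
  ⊗-centring c M rows i j = begin
    sumFin (λ t → M i t * centring c t j)
      ≡⟨ sumFin-cong (λ t → trans (*-δ-minus (M i t) (eqF t j) c)
                                  (cong (_- c * M i t) (trans (sym (if-eqF-at t j (M i)))
                                                               (cong (λ b → if b then M i j else 0ℚ) (eqF-sym t j))))) ⟩
    sumFin (λ t → (if eqF j t then M i j else 0ℚ) - c * M i t)
      ≡⟨ sumFin-δ-minus j (M i j) c (M i) (rows i) ⟩
    M i j ∎

  centring-⊗ : ∀ c (M : Matrix n) → ColSumsZero M → (centring c ⊗ M) ≐ M
  centring-⊗ c M cols i j = begin
    sumFin (λ t → centring c i t * M t j)
      ≡⟨ sumFin-cong (λ t → trans (*-comm _ (M t j))
                     (trans (*-δ-minus (M t j) (eqF i t) c) (cong (_- c * M t j) (if-eqF-at i t (λ s → M s j))))) ⟩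
    sumFin (λ t → (if eqF i t then M i j else 0ℚ) - c * M t j)
      ≡⟨ sumFin-δ-minus i (M i j) c (λ t → M t j) (cols j) ⟩
    M i j ∎

  ≐-setoid : Setoid 0ℓ 0ℓ
  ≐-setoid = record
    { Carrier       = Matrix n
    ; _≈_           = _≐_
    ; isEquivalence = record { refl = λ _ _ → refl ; sym = ≐-sym ; trans = ≐-trans }
    }

  groupInverse-unique : ∀ c {L X Z : Matrix n} → IsGroupInverse L X →
    RowSumsZero L → ColSumsZero Z → (L ⊗ Z) ≐ centring c → X ≐ Z
  groupInverse-unique c {L} {X} {Z} gi L-rows Z-cols LZ≐P = beginᴹ
    X                  ≈⟨ XLX≡X ⟨
    (X ⊗ L) ⊗ X        ≈⟨ ⊗-assoc X L X ⟩
    X ⊗ (L ⊗ X)        ≈⟨ ⊗-congʳ X (≐-trans LX≡XL XL≐P) ⟩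
    X ⊗ centring c     ≈⟨ ⊗-congʳ X LZ≐P ⟨
    X ⊗ (L ⊗ Z)        ≈⟨ ⊗-assoc X L Z ⟨
    (X ⊗ L) ⊗ Z        ≈⟨ ⊗-congˡ Z XL≐P ⟩
    centring c ⊗ Z     ≈⟨ centring-⊗ c Z Z-cols ⟩
    Z                  ∎ᴹ
    where
    open IsGroupInverse gi
    open import Relation.Binary.Reasoning.Setoid ≐-setoid
      using (step-≈-⟩; step-≈-⟨) renaming (begin_ to beginᴹ_; _∎ to _∎ᴹ)

    XL-rows : RowSumsZero (X ⊗ L)
    XL-rows i = begin
      sumFin (λ t → sumFin (λ s → X i s * L s t)) ≡⟨ sumFin-comm (λ t s → X i s * L s t) ⟩
      sumFin (λ s → sumFin (λ t → X i s * L s t)) ≡⟨ sumFin-cong (λ s → sumFin-*ˡ (X i s) (L s)) ⟩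
      sumFin (λ s → X i s * sumFin (L s))         ≡⟨ sumFin-cong (λ s → cong (X i s *_) (L-rows s)) ⟩
      sumFin (λ s → X i s * 0ℚ)                   ≡⟨ sumFin-cong (λ s → *-zeroʳ (X i s)) ⟩
      sumFin {n} (λ _ → 0ℚ)                       ≡⟨ sumFin-zero n ⟩
      0ℚ                                          ∎

    XL≐P : (X ⊗ L) ≐ centring c
    XL≐P = beginᴹ
      X ⊗ L                  ≈⟨ ⊗-centring c (X ⊗ L) XL-rows ⟨
      (X ⊗ L) ⊗ centring c   ≈⟨ ⊗-congʳ (X ⊗ L) LZ≐P ⟨
      (X ⊗ L) ⊗ (L ⊗ Z)      ≈⟨ ⊗-assoc (X ⊗ L) L Z ⟨
      ((X ⊗ L) ⊗ L) ⊗ Z      ≈⟨ ⊗-congˡ Z (≐-trans (⊗-congˡ L (≐-sym LX≡XL)) LXL≡L) ⟩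
      L ⊗ Z                  ≈⟨ LZ≐P ⟩
      centring c             ∎ᴹ

module _ {n : ℕ} (G : SimpleGraph n) where
  open SimpleGraph G

  laplacian-apply : ∀ x (F : Fin n → ℚ) →
    sumFin (λ t → laplacian G x t * F t) ≡ sumFin (λ t → if adj x t then F x - F t else 0ℚ)
  laplacian-apply x F = begin
    sumFin (λ t → laplacian G x t * F t)
      ≡⟨ sumFin-cong entry ⟩
    sumFin (λ t → if eqF x t then fromℕ (deg G x) * F x else −F t)
      ≡⟨ sumFin-δ x (fromℕ (deg G x) * F x) −F_ (cong (λ b → if b then - F x else 0ℚ) (irrefl x)) ⟩
    fromℕ (deg G x) * F x + sumFin −F_
      ≡⟨ cong (_+ sumFin −F_) (sumFin-if (adj x) (F x)) ⟨
    sumFin (λ t → if adj x t then F x else 0ℚ) + sumFin −F_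
      ≡⟨ sumFin-+ (λ t → if adj x t then F x else 0ℚ) −F_ ⟨
    sumFin (λ t → (if adj x t then F x else 0ℚ) + −F t)
      ≡⟨ sumFin-cong (λ t → if-+ (adj x t) t) ⟩
    sumFin (λ t → if adj x t then F x - F t else 0ℚ) ∎
    where
    −F_ : Fin n → ℚ
    −F t = if adj x t then - F t else 0ℚ
    entry : ∀ t → laplacian G x t * F t ≡ (if eqF x t then fromℕ (deg G x) * F x else −F t)
    entry t with eqF x t in x≟t
    ... | true  rewrite eqF⇒≡ x≟t = refl
    ... | false with adj x t
    ...   | true  = solve 1 (λ u → (:- con 1ℚ) :* u := :- u) refl (F t)
    ...   | false = *-zeroˡ (F t)
    if-+ : ∀ b t → (if b then F x else 0ℚ) + (if b then - F t else 0ℚ) ≡ (if b then F x - F t else 0ℚ)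
    if-+ true  t = refl
    if-+ false t = +-identityʳ 0ℚ

  laplacian-rowSums : RowSumsZero (laplacian G)
  laplacian-rowSums x = begin
    sumFin (laplacian G x)                          ≡⟨ sumFin-cong (λ t → sym (*-identityʳ (laplacian G x t))) ⟩
    sumFin (λ t → laplacian G x t * 1ℚ)             ≡⟨ laplacian-apply x (λ _ → 1ℚ) ⟩
    sumFin (λ t → if adj x t then 1ℚ - 1ℚ else 0ℚ)  ≡⟨ sumFin-cong (λ t → if-0 (adj x t)) ⟩
    sumFin {n} (λ _ → 0ℚ)                           ≡⟨ sumFin-zero n ⟩
    0ℚ                                              ∎
    where
    if-0 : ∀ b → (if b then 1ℚ - 1ℚ else 0ℚ) ≡ 0ℚ
    if-0 true  = refl
    if-0 false = refl

-- Distance-biregular graphs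

module DistanceBiregular {n : ℕ} {G : SimpleGraph n} {side : Fin n → Bool} {k : Bool → ℕ}
                         {c b : Bool → ℕ → ℕ} (dbr : IsDistanceBiregular G side k c b) where
  open SimpleGraph G
  open IsDistanceBiregular dbr
  open Distance G
  open Distance.WhenConnected G connected

  private
    if-∧-false : ∀ p (q : ℚ) → (if p ∧ false then q else 0ℚ) ≡ 0ℚ
    if-∧-false true  q = refl
    if-∧-false false q = refl

  side-by-distance : ∀ m y w → dist G y w ≡ m → side w ≡ fold (side y) not m
  side-by-distance zero    y w d≡0 = cong side (sym (dist≡0⇒≡ d≡0))
  side-by-distance (suc m) y w d≡ with dist-predecessor d≡
  ... | t , t~w , d≡m = trans (other-side (bipartite t w t~w)) (cong not (side-by-distance m y t d≡m))
    where
    other-side : ∀ {p q : Bool} → p ≢ q → q ≡ not p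
    other-side {true}  {true}  p≢q = ⊥-elim (p≢q refl)
    other-side {true}  {false} _   = refl
    other-side {false} {true}  _   = refl
    other-side {false} {false} p≢q = ⊥-elim (p≢q refl)

  adj-dist-±1 : ∀ y {x t} → adj x t ≡ true →
    dist G y t ≡ suc (dist G y x) ⊎ dist G y x ≡ suc (dist G y t)
  adj-dist-±1 y {x} {t} x~t with ℕ.<-cmp (dist G y x) (dist G y t)
  ... | tri< lt _ _ = inj₁ (ℕ.≤-antisym (dist-adj-≤ x~t) lt)
  ... | tri≈ _ eq _ = ⊥-elim (bipartite x t x~t (trans (side-by-distance _ y x refl)
                        (trans (cong (fold (side y) not) eq) (sym (side-by-distance _ y t refl)))))
  ... | tri> _ _ gt = inj₂ (ℕ.≤-antisym (dist-adj-≤ (trans (symm t x) x~t)) gt)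

  dist-≤-diamSide : ∀ y x → dist G y x ≤ diamSide G side (side y)
  dist-≤-diamSide y x = ℕ.≤-trans (maxFin-≥ (dist G y) x)
    (subst (λ v → (if v then ecc G y else 0) ≤ diamSide G side (side y)) (side≟side (side y))
           (maxFin-≥ (λ z → if ⌊ side z Data.Bool.≟ side y ⌋ then ecc G z else 0) y))
    where
    side≟side : ∀ ℓ → ⌊ ℓ Data.Bool.≟ ℓ ⌋ ≡ true
    side≟side true  = refl
    side≟side false = refl

  sphere-pos : ∀ y x → 1 ≤ sphere G y (dist G y x)
  sphere-pos y x = countFin-pos (λ z → dist G y z ≡ᵇ dist G y x) x (≡ᵇ-refl (dist G y x))

  c-pos : ∀ y x i → dist G y x ≡ suc i → 1 ≤ c (side y) (suc i)
  c-pos y x i d≡ with dist-predecessor d≡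
  ... | t , t~x , d≡i = subst (1 ≤_) (c-const y x i d≡)
    (countFin-pos (λ z → (dist G y z ≡ᵇ i) ∧ (dist G x z ≡ᵇ 1)) t
      (cong₂ _∧_ (subst (λ m → (dist G y t ≡ᵇ m) ≡ true) d≡i (≡ᵇ-refl (dist G y t)))
                 (trans (dist≡ᵇ1≡adj x t) (trans (symm x t) t~x))))

  sphere-zero : ∀ y → sphere G y 0 ≡ 1
  sphere-zero y = trans (countFin-cong at-zero) (countFin-eqF y)
    where
    at-zero : ∀ z → (dist G y z ≡ᵇ 0) ≡ eqF y z
    at-zero z with dist G y z in d
    ... | zero  = sym (trans (cong (eqF y) (sym (dist≡0⇒≡ d))) (eqF-refl y))
    ... | suc _ =
      sym (≢⇒eqF-false (λ y≡z → ℕ.0≢1+n (trans (sym (dist-refl y)) (trans (cong (dist G y) y≡z) d))))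

  sphere-gap : ∀ y i → sphere G y (suc i) ≡ 0 → ∀ x → dist G y x ≤ i
  sphere-gap y i k≡0 x with dist G y x ℕ.≤? i
  ... | yes d≤i = d≤i
  ... | no  d≰i = ⊥-elim (true≢false (trans (sym (≡ᵇ-refl (suc i)))
                    (subst (λ m → (m ≡ᵇ suc i) ≡ false) (proj₂ far) (countFin≡0 _ k≡0 (proj₁ far)))))
    where
    descend : ∀ m x → dist G y x ≡ m → suc i ≤ m → ∃ λ w → dist G y w ≡ suc i
    descend (suc m) x d≡ i<m with i ℕ.≟ m
    ... | yes refl = x , d≡
    ... | no  i≢m  with dist-predecessor d≡
    ...   | t , _ , d≡m = descend m t d≡m (ℕ.≤∧≢⇒< (ℕ.≤-pred i<m) i≢m)
    far = descend (dist G y x) x refl (ℕ.≰⇒> d≰i)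

  sumFin-by-distance : ∀ y (h : ℕ → ℚ) →
    sumFin (λ x → h (dist G y x)) ≡
    sumBelow (suc (diamSide G side (side y))) (λ i → fromℕ (sphere G y i) * h i)
  sumFin-by-distance y h = sumFin-by-level (dist G y) _ h (λ x → s≤s (dist-≤-diamSide y x))

  ball-full : ∀ y i → (∀ x → dist G y x ≤ i) → fromℕ (ball G y i) ≡ fromℕ n
  ball-full y i within = begin
    fromℕ (ball G y i)
      ≡⟨ fromℕ-sumBelowℕ (suc i) (sphere G y) ⟩
    sumBelow (suc i) (λ j → fromℕ (sphere G y j))
      ≡⟨ sumBelow-cong (suc i) (λ j _ → *-identityʳ _) ⟨
    sumBelow (suc i) (λ j → fromℕ (sphere G y j) * 1ℚ)
      ≡⟨ sumFin-by-level (dist G y) (suc i) (λ _ → 1ℚ) (λ x → s≤s (within x)) ⟨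
    sumFin {n} (λ _ → 1ℚ)
      ≡⟨ sumFin-one n ⟩
    fromℕ n ∎

  double-count : ∀ y i →
    fromℕ (sphere G y i) * fromℕ (b (side y) i) ≡
    fromℕ (sphere G y (suc i)) * fromℕ (c (side y) (suc i))
  double-count y i = begin
    fromℕ (sphere G y i) * fromℕ (b (side y) i)
      ≡⟨ sumFin-if (λ z → dist G y z ≡ᵇ i) _ ⟨
    sumFin (λ z → if dist G y z ≡ᵇ i then fromℕ (b (side y) i) else 0ℚ)
      ≡⟨ sumFin-cong (λ z → sym (row z)) ⟩
    sumFin (λ z → sumFin (λ w → edge z w))
      ≡⟨ sumFin-comm edge ⟩
    sumFin (λ w → sumFin (λ z → edge z w))
      ≡⟨ sumFin-cong column ⟩
    sumFin (λ w → if dist G y w ≡ᵇ suc i then fromℕ (c (side y) (suc i)) else 0ℚ)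
      ≡⟨ sumFin-if (λ w → dist G y w ≡ᵇ suc i) _ ⟩
    fromℕ (sphere G y (suc i)) * fromℕ (c (side y) (suc i)) ∎
    where
    edge : Fin n → Fin n → ℚ
    edge z w = if (dist G y z ≡ᵇ i) ∧ ((dist G y w ≡ᵇ suc i) ∧ adj z w) then 1ℚ else 0ℚ

    row : ∀ z → sumFin (edge z) ≡ (if dist G y z ≡ᵇ i then fromℕ (b (side y) i) else 0ℚ)
    row z with dist G y z ≡ᵇ i in d≡
    ... | false = sumFin-zero n
    ... | true  = trans (sumFin-if (λ w → (dist G y w ≡ᵇ suc i) ∧ adj z w) 1ℚ)
                   (trans (*-identityʳ _) (cong fromℕ (trans
                     (countFin-cong (λ w → cong ((dist G y w ≡ᵇ suc i) ∧_) (sym (dist≡ᵇ1≡adj z w))))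
                     (b-const y z i (≡ᵇ⇒≡ d≡)))))

    column : ∀ w →
      sumFin (λ z → edge z w) ≡ (if dist G y w ≡ᵇ suc i then fromℕ (c (side y) (suc i)) else 0ℚ)
    column w with dist G y w ≡ᵇ suc i in d≡
    ... | false = trans (sumFin-cong (λ z → if-∧-false (dist G y z ≡ᵇ i) 1ℚ)) (sumFin-zero n)
    ... | true  = trans (sumFin-if (λ z → (dist G y z ≡ᵇ i) ∧ adj z w) 1ℚ)
                   (trans (*-identityʳ _) (cong fromℕ (trans
                     (countFin-cong (λ z → cong ((dist G y z ≡ᵇ i) ∧_)
                                                (trans (symm z w) (sym (dist≡ᵇ1≡adj w z)))))
                     (c-const y w i (≡ᵇ⇒≡ d≡)))))

  neighbour-sum-centre : ∀ y (α : ℕ → ℚ) →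
    sumFin (λ t → if adj y t then α (dist G y t) else 0ℚ) ≡ fromℕ (b (side y) 0) * α 1
  neighbour-sum-centre y α = begin
    sumFin (λ t → if adj y t then α (dist G y t) else 0ℚ)
      ≡⟨ sumFin-cong at-one ⟩
    sumFin (λ t → if (dist G y t ≡ᵇ 1) ∧ (dist G y t ≡ᵇ 1) then α 1 else 0ℚ)
      ≡⟨ sumFin-if (λ t → (dist G y t ≡ᵇ 1) ∧ (dist G y t ≡ᵇ 1)) (α 1) ⟩
    fromℕ (countFin (λ t → (dist G y t ≡ᵇ 1) ∧ (dist G y t ≡ᵇ 1))) * α 1
      ≡⟨ cong (λ m → fromℕ m * α 1) (b-const y y 0 (dist-refl y)) ⟩
    fromℕ (b (side y) 0) * α 1 ∎
    where
    at-one : ∀ t → (if adj y t then α (dist G y t) else 0ℚ) ≡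
                   (if (dist G y t ≡ᵇ 1) ∧ (dist G y t ≡ᵇ 1) then α 1 else 0ℚ)
    at-one t with adj y t in y~t
    ... | true  rewrite adj⇒dist≡1 y~t = refl
    ... | false rewrite dist≡ᵇ1≡adj y t | y~t = refl

  neighbour-sum : ∀ y x i (α : ℕ → ℚ) → dist G y x ≡ suc i →
    sumFin (λ t → if adj x t then α (dist G y t) else 0ℚ) ≡
    fromℕ (c (side y) (suc i)) * α i + fromℕ (b (side y) (suc i)) * α (suc (suc i))
  neighbour-sum y x i α d≡ = begin
    sumFin (λ t → if adj x t then α (dist G y t) else 0ℚ)
      ≡⟨ sumFin-cong split ⟩
    sumFin (λ t → (if inner t then α i else 0ℚ) + (if outer t then α (suc (suc i)) else 0ℚ))
      ≡⟨ sumFin-+ (λ t → if inner t then α i else 0ℚ) (λ t → if outer t then α (suc (suc i)) else 0ℚ) ⟩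
    sumFin (λ t → if inner t then α i else 0ℚ) +
    sumFin (λ t → if outer t then α (suc (suc i)) else 0ℚ)
      ≡⟨ cong₂ _+_ (sumFin-if inner (α i)) (sumFin-if outer (α (suc (suc i)))) ⟩
    fromℕ (countFin inner) * α i + fromℕ (countFin outer) * α (suc (suc i))
      ≡⟨ cong₂ (λ u v → fromℕ u * α i + fromℕ v * α (suc (suc i)))
               (c-const y x i d≡) (b-const y x (suc i) d≡) ⟩
    fromℕ (c (side y) (suc i)) * α i + fromℕ (b (side y) (suc i)) * α (suc (suc i)) ∎
    where
    inner outer : Fin n → Bool
    inner t = (dist G y t ≡ᵇ i) ∧ (dist G x t ≡ᵇ 1)
    outer t = (dist G y t ≡ᵇ suc (suc i)) ∧ (dist G x t ≡ᵇ 1)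

    2+i≢i : ∀ m → suc (suc m) ≢ m
    2+i≢i m eq = ℕ.<-irrefl (sym eq) (ℕ.m≤n⇒m≤1+n ℕ.≤-refl)

    split : ∀ t → (if adj x t then α (dist G y t) else 0ℚ) ≡
                  (if inner t then α i else 0ℚ) + (if outer t then α (suc (suc i)) else 0ℚ)
    split t rewrite dist≡ᵇ1≡adj x t with adj x t in x~t
    ... | false = sym (trans (cong₂ _+_ (if-∧-false (dist G y t ≡ᵇ i) (α i))
                                        (if-∧-false (dist G y t ≡ᵇ suc (suc i)) (α (suc (suc i)))))
                             (+-identityʳ 0ℚ))
    ... | true with adj-dist-±1 y x~t
    ...   | inj₁ d≡2+i rewrite d≡2+i | d≡ | ≢⇒≡ᵇ-false (2+i≢i i) | ≡ᵇ-refl i = sym (+-identityˡ _)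
    ...   | inj₂ d≡1+d rewrite ℕ.suc-injective (trans (sym d≡) d≡1+d) | ≡ᵇ-refl (dist G y t)
                             | ≢⇒≡ᵇ-false (λ e → 2+i≢i (dist G y t) (sym e)) = sym (+-identityʳ _)

  sphere-witness : ∀ y j {m} → sphere G y j ≡ suc m → ∃ λ w → dist G y w ≡ j
  sphere-witness y j k≡ = let (w , d≡) = countFin-witness (λ z → dist G y z ≡ᵇ j) k≡ in w , ≡ᵇ⇒≡ d≡

  sphere*c≡0 : ∀ y i → sphere G y (suc i) ℕ.* c (side y) (suc i) ≡ 0 → sphere G y (suc i) ≡ 0
  sphere*c≡0 y i kc≡0 with ℕ.m*n≡0⇒m≡0∨n≡0 (sphere G y (suc i)) kc≡0
  ... | inj₁ k≡0 = k≡0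
  ... | inj₂ c≡0 with sphere G y (suc i) in k≡
  ...   | zero  = refl
  ...   | suc m =
    let (w , d≡) = sphere-witness y (suc i) k≡ in ⊥-elim (ℕ.<-irrefl (sym c≡0) (c-pos y w i d≡))

  module Column (y : Fin n) where

    ℓ : Bool
    ℓ = side y

    D : ℕ
    D = diamSide G side ℓ

    a e : ℕ → ℚ
    a j = (ℤ.+ n ℤ.- ℤ.+ ball G y (j ∸ 1)) /ₜ (sphere G y j ℕ.* c ℓ j)
    e j = (ℤ.+ ball G y (j ∸ 1) ℤ.* (ℤ.+ n ℤ.- ℤ.+ ball G y (j ∸ 1))) /ₜ (sphere G y j ℕ.* c ℓ j)

    q r K : ℚ
    q = (ℤ.+ 1) /ₜ n
    r = (ℤ.+ 1) /ₜ (n ℕ.* n)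
    K = r * sumRange 1 D e

    profile : ℕ → ℚ
    profile i = q * sumRange (suc i) D a - K

    q*n≡1 : q * fromℕ n ≡ 1ℚ
    q*n≡1 = go n y
      where
      go : ∀ m → Fin m → ((ℤ.+ 1) /ₜ m) * fromℕ m ≡ 1ℚ
      go (suc m) _ = /ₜ-*-cancel (ℤ.+ 1) m

    r*n≡q : r * fromℕ n ≡ q
    r*n≡q = go n y
      where
      go : ∀ m → Fin m → ((ℤ.+ 1) /ₜ (m ℕ.* m)) * fromℕ m ≡ (ℤ.+ 1) /ₜ m
      go (suc m) _ = /ₜ-unique (ℤ.+ 1) m (begin
        r′ * fromℕ (suc m) * fromℕ (suc m)    ≡⟨ *-assoc r′ _ _ ⟩
        r′ * (fromℕ (suc m) * fromℕ (suc m))  ≡⟨ cong (r′ *_) (fromℕ-* (suc m) (suc m)) ⟨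
        r′ * fromℕ (suc m ℕ.* suc m)          ≡⟨ /ₜ-*-cancel (ℤ.+ 1) (m ℕ.+ m ℕ.* suc m) ⟩
        1ℚ                                    ∎)
        where r′ = (ℤ.+ 1) /ₜ (suc m ℕ.* suc m)

    profile-step : ∀ i → profile i - profile (suc i) ≡ q * (if suc i ≤ᵇ D then a (suc i) else 0ℚ)
    profile-step i = begin
      q * sumRange (suc i) D a - K - (q * S - K)
        ≡⟨ cong (λ z → q * z - K - (q * S - K)) (sumRange-suc i D a) ⟩
      q * (A + S) - K - (q * S - K)
        ≡⟨ solve 4 (λ q A S K → q :* (A :+ S) :- K :- (q :* S :- K) := q :* A) refl q A S K ⟩
      q * A ∎
      where
      A = if suc i ≤ᵇ D then a (suc i) else 0ℚ
      S = sumRange (suc (suc i)) D a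

    -- Multiplying by k_{i+1} c_{i+1} clears the denominator; when it vanishes, so does n - B_i.
    profile-drop : ∀ i → fromℕ (sphere G y (suc i) ℕ.* c ℓ (suc i)) * (profile i - profile (suc i)) ≡
                         q * (fromℕ n - fromℕ (ball G y i))
    profile-drop i with sphere G y (suc i) ℕ.* c ℓ (suc i) in kc
    ... | zero = begin
      0ℚ * (profile i - profile (suc i))
        ≡⟨ *-zeroˡ (profile i - profile (suc i)) ⟩
      0ℚ
        ≡⟨ solve 2 (λ q m → con 0ℚ := q :* (m :- m)) refl q (fromℕ n) ⟩
      q * (fromℕ n - fromℕ n)
        ≡⟨ cong (λ m → q * (fromℕ n - m)) (ball-full y i (sphere-gap y i (sphere*c≡0 y i kc))) ⟨
      q * (fromℕ n - fromℕ (ball G y i)) ∎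
    ... | suc m = begin
      fromℕ (suc m) * (profile i - profile (suc i))
        ≡⟨ cong (fromℕ (suc m) *_) (profile-step i) ⟩
      fromℕ (suc m) * (q * (if suc i ≤ᵇ D then a (suc i) else 0ℚ))
        ≡⟨ cong (λ v → fromℕ (suc m) * (q * (if v then a (suc i) else 0ℚ))) (≤ᵇ-true 1+i≤D) ⟩
      fromℕ (suc m) * (q * a (suc i))
        ≡⟨ solve 3 (λ k q a → k :* (q :* a) := q :* (a :* k)) refl (fromℕ (suc m)) q (a (suc i)) ⟩
      q * (a (suc i) * fromℕ (suc m))
        ≡⟨ cong (λ d → q * (N /ₜ d * fromℕ (suc m))) kc ⟩
      q * (N /ₜ suc m * fromℕ (suc m))
        ≡⟨ cong (q *_) (/ₜ-*-cancel N m) ⟩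
      q * fromℤ N
        ≡⟨ cong (q *_) (fromℤ-minus (ℤ.+ n) (ℤ.+ ball G y i)) ⟩
      q * (fromℕ n - fromℕ (ball G y i)) ∎
      where
      N = ℤ.+ n ℤ.- ℤ.+ ball G y i
      1+i≤D : suc i ≤ D
      1+i≤D with sphere G y (suc i) in k≡
      ... | zero  = ⊥-elim (ℕ.0≢1+n kc)
      ... | suc _ = let (w , d≡) = sphere-witness y (suc i) k≡ in subst (_≤ D) d≡ (dist-≤-diamSide y w)

    variation : Fin n → ℚ
    variation x = sumFin (λ t → if adj x t then profile (dist G y x) - profile (dist G y t) else 0ℚ)

    variation-centre : variation y ≡ 1ℚ - q
    variation-centre = begin
      variation y
        ≡⟨ neighbour-sum-centre y (λ d → profile (dist G y y) - profile d) ⟩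
      fromℕ (b ℓ 0) * (profile (dist G y y) - profile 1)
        ≡⟨ cong (λ d → fromℕ (b ℓ 0) * (profile d - profile 1)) (dist-refl y) ⟩
      fromℕ (b ℓ 0) * (profile 0 - profile 1)
        ≡⟨ cong (_* (profile 0 - profile 1)) (*-identityˡ (fromℕ (b ℓ 0))) ⟨
      1ℚ * fromℕ (b ℓ 0) * (profile 0 - profile 1)
        ≡⟨ cong (λ k₀ → fromℕ k₀ * fromℕ (b ℓ 0) * (profile 0 - profile 1)) (sphere-zero y) ⟨
      fromℕ (sphere G y 0) * fromℕ (b ℓ 0) * (profile 0 - profile 1)
        ≡⟨ cong (_* (profile 0 - profile 1))
                (trans (double-count y 0) (sym (fromℕ-* (sphere G y 1) (c ℓ 1)))) ⟩
      fromℕ (sphere G y 1 ℕ.* c ℓ 1) * (profile 0 - profile 1)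
        ≡⟨ profile-drop 0 ⟩
      q * (fromℕ n - fromℕ (ball G y 0))
        ≡⟨ cong (λ k₀ → q * (fromℕ n - fromℕ k₀)) (sphere-zero y) ⟩
      q * (fromℕ n - 1ℚ)
        ≡⟨ solve 2 (λ q m → q :* (m :- con 1ℚ) := q :* m :- q) refl q (fromℕ n) ⟩
      q * fromℕ n - q
        ≡⟨ cong (_- q) q*n≡1 ⟩
      1ℚ - q ∎

    variation-off-centre : ∀ x i → dist G y x ≡ suc i → variation x ≡ 0ℚ - q
    variation-off-centre x i d≡ = *-cancelʳ-nonZero κ {{κ≢0}} (begin
      variation x * κ
        ≡⟨ cong (_* κ) (trans (sumFin-cong (λ t → cong (λ d → if adj x t then profile d - profile (dist G y t) else 0ℚ) d≡))
                              (neighbour-sum y x i (λ d → profile (suc i) - profile d) d≡)) ⟩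
      (γ * (p₁ - p₀) + β * (p₁ - p₂)) * κ
        ≡⟨ solve 6 (λ γ β κ p₀ p₁ p₂ → (γ :* (p₁ :- p₀) :+ β :* (p₁ :- p₂)) :* κ
                                      := κ :* β :* (p₁ :- p₂) :- κ :* γ :* (p₀ :- p₁)) refl γ β κ p₀ p₁ p₂ ⟩
      κ * β * (p₁ - p₂) - κ * γ * (p₀ - p₁)
        ≡⟨ cong₂ (λ u v → u * (p₁ - p₂) - v * (p₀ - p₁))
                 (trans (double-count y (suc i)) (sym (fromℕ-* (sphere G y (suc (suc i))) (c ℓ (suc (suc i))))))
                 (sym (fromℕ-* (sphere G y (suc i)) (c ℓ (suc i)))) ⟩
      fromℕ (sphere G y (suc (suc i)) ℕ.* c ℓ (suc (suc i))) * (p₁ - p₂) -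
      fromℕ (sphere G y (suc i) ℕ.* c ℓ (suc i)) * (p₀ - p₁)
        ≡⟨ cong₂ _-_ (profile-drop (suc i)) (profile-drop i) ⟩
      q * (fromℕ n - fromℕ (ball G y (suc i))) - q * (fromℕ n - B)
        ≡⟨ cong (λ B′ → q * (fromℕ n - B′) - q * (fromℕ n - B)) (fromℕ-+ (ball G y i) _) ⟩
      q * (fromℕ n - (B + κ)) - q * (fromℕ n - B)
        ≡⟨ solve 4 (λ q m B κ → q :* (m :- (B :+ κ)) :- q :* (m :- B) := (con 0ℚ :- q) :* κ)
                   refl q (fromℕ n) B κ ⟩
      (0ℚ - q) * κ ∎)
      where
      γ β κ B p₀ p₁ p₂ : ℚ
      γ  = fromℕ (c ℓ (suc i))
      β  = fromℕ (b ℓ (suc i))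
      κ  = fromℕ (sphere G y (suc i))
      B  = fromℕ (ball G y i)
      p₀ = profile i
      p₁ = profile (suc i)
      p₂ = profile (suc (suc i))

      κ≢0 : NonZero κ
      κ≢0 with sphere G y (suc i) | subst (λ d → 1 ≤ sphere G y d) d≡ (sphere-pos y x)
      ... | suc m | _ = fromℕ-suc-nonZero m

    laplacian-profile : ∀ x → sumFin (λ t → laplacian G x t * profile (dist G t y)) ≡ centring q x y
    laplacian-profile x = begin
      sumFin (λ t → laplacian G x t * profile (dist G t y))
        ≡⟨ sumFin-cong (λ t → cong (λ d → laplacian G x t * profile d) (dist-sym t y)) ⟩
      sumFin (λ t → laplacian G x t * profile (dist G y t))
        ≡⟨ laplacian-apply G x (λ t → profile (dist G y t)) ⟩
      variation x
        ≡⟨ by-distance (dist G y x) refl ⟩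
      centring q x y ∎
      where
      by-distance : ∀ d → dist G y x ≡ d → variation x ≡ centring q x y
      by-distance zero    d≡0 with refl ← dist≡0⇒≡ d≡0 =
        trans variation-centre (cong (λ v → (if v then 1ℚ else 0ℚ) - q) (sym (eqF-refl y)))
      by-distance (suc i) d≡  =
        trans (variation-off-centre x i d≡) (cong (λ v → (if v then 1ℚ else 0ℚ) - q) (sym (≢⇒eqF-false x≢y)))
        where
        x≢y : x ≢ y
        x≢y refl = ℕ.0≢1+n (trans (sym (dist-refl x)) d≡)

    profile-colSum : sumFin (λ x → profile (dist G x y)) ≡ 0ℚ
    profile-colSum = begin
      sumFin (λ x → profile (dist G x y))
        ≡⟨ sumFin-cong (λ x → cong profile (dist-sym x y)) ⟩
      sumFin (λ x → profile (dist G y x))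
        ≡⟨ sumFin-by-distance y profile ⟩
      sumBelow (suc D) (λ i → κ i * profile i)
        ≡⟨ sumBelow-cong (suc D) (λ i _ → solve 4 (λ κ q S K → κ :* (q :* S :- K) := q :* (κ :* S) :+ (:- K) :* κ)
                                                  refl (κ i) q (S i) K) ⟩
      sumBelow (suc D) (λ i → q * (κ i * S i) + (- K) * κ i)
        ≡⟨ sumBelow-+ (suc D) (λ i → q * (κ i * S i)) (λ i → (- K) * κ i) ⟩
      sumBelow (suc D) (λ i → q * (κ i * S i)) + sumBelow (suc D) (λ i → (- K) * κ i)
        ≡⟨ cong₂ _+_ (sumBelow-*ˡ (suc D) q (λ i → κ i * S i)) (sumBelow-*ˡ (suc D) (- K) κ) ⟩
      q * sumBelow (suc D) (λ i → κ i * S i) + (- K) * sumBelow (suc D) κ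
        ≡⟨ cong₂ (λ u v → q * u + (- K) * v) weighted total ⟩
      q * W + (- (r * W)) * fromℕ n
        ≡⟨ solve 4 (λ q r W m → q :* W :+ (:- (r :* W)) :* m := q :* W :- W :* (r :* m)) refl q r W (fromℕ n) ⟩
      q * W - W * (r * fromℕ n)
        ≡⟨ cong (λ z → q * W - W * z) r*n≡q ⟩
      q * W - W * q
        ≡⟨ solve 2 (λ q W → q :* W :- W :* q := con 0ℚ) refl q W ⟩
      0ℚ ∎
      where
      κ S : ℕ → ℚ
      κ i = fromℕ (sphere G y i)
      S i = sumRange (suc i) D a
      W : ℚ
      W = sumRange 1 D e

      weighted : sumBelow (suc D) (λ i → κ i * S i) ≡ W
      weighted = trans (sumBelow-sumRange D κ a) (sumBelow-cong D (λ t _ → begin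
        sumBelow (suc t) κ * a (suc t)
          ≡⟨ cong (_* a (suc t)) (fromℕ-sumBelowℕ (suc t) (sphere G y)) ⟨
        fromℕ (ball G y t) * a (suc t)
          ≡⟨ /ₜ-*ˡ (ℤ.+ ball G y t) (ℤ.+ n ℤ.- ℤ.+ ball G y t) (sphere G y (suc t) ℕ.* c ℓ (suc t)) ⟨
        e (suc t) ∎))

      total : sumBelow (suc D) κ ≡ fromℕ n
      total = trans (sym (fromℕ-sumBelowℕ (suc D) (sphere G y))) (ball-full y D (dist-≤-diamSide y))

  distanceMatrix : Matrix n
  distanceMatrix x y = Column.profile y (dist G x y)

  laplacian-⊗-distanceMatrix : (laplacian G ⊗ distanceMatrix) ≐ centring ((ℤ.+ 1) /ₜ n)
  laplacian-⊗-distanceMatrix x y = Column.laplacian-profile y x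

  distanceMatrix-colSums : ColSumsZero distanceMatrix
  distanceMatrix-colSums y = Column.profile-colSum y

open import Data.Nat using () renaming (_*_ to _*ℕ_)
open import Data.Integer using (+_) renaming (_-_ to _-ℤ_; _*_ to _*ℤ_)

theorem3p8 : (n : ℕ) → 2 ≤ n → (G : SimpleGraph n) →
    (side : Fin n → Bool) (k : Bool → ℕ) (c b : Bool → ℕ → ℕ) →
    IsDistanceBiregular G side k c b →
    (X : Matrix n) → IsGroupInverse (laplacian G) X →
    (x y : Fin n) →
    X x y ≡
      (((+ 1) /ₜ n) * sumRange (suc (dist G x y)) (diamSide G side (side y))
          (λ j → (+ n -ℤ + ball G y (j ∸ 1)) /ₜ (sphere G y j *ℕ c (side y) j)))
      - (((+ 1) /ₜ (n *ℕ n)) * sumRange 1 (diamSide G side (side y))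
          (λ j → (+ ball G y (j ∸ 1) *ℤ (+ n -ℤ + ball G y (j ∸ 1)))
                   /ₜ (sphere G y j *ℕ c (side y) j)))
theorem3p8 n _ G side k c b dbr X X-inverse =
  groupInverse-unique _ X-inverse (laplacian-rowSums G) distanceMatrix-colSums laplacian-⊗-distanceMatrix
  where open DistanceBiregular dbr
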